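{- Let $G$ be a graph with $n\ge4$ vertices and $M=M[IAS(G)]$. Then $\kappa(M)<n$ if and only if some graph locally equivalent to $G$ has a vertex of degree $<\frac{n-1}{2}$.
   Context: A graph is a finite looped simple graph; neighbors are via non-loop edges only, $N_G(v)=\{w\neq v\mid vw\in E(G)\}$, and the degree of $v$ is $|N_G(v)|$. $A(G)$ is the $GF(2)$ adjacency matrix (diagonal entry 1 iff looped). $M[IAS(G)]$ is the binary matroid represented by $(I\;A(G)\;A(G)+I)$. For a matroid $M$ on $W$ with rank $r$, $\lambda(S)=r(S)+r(W-S)-r(M)$; $S$ is a vertical $k$-separation if $\lambda(S)<k$ and $r(S),r(W-S)\ge k$; $\kappa(M)=\min(\{k\mid M\text{ has a vertical }k\text{ -separation}\}\cup\{r(M)\})$. Local equivalence: the loop complement at $v$ reverses the loop status of $v$; the simple local complement at $v$ reverses all adjacencies between distinct elements of $N_G(v)$; the non-simple local complement at $v$ additionally reverses loop status at every vertex of $N_G(v)$. Graphs (on the same vertex set) are locally equivalent if one is obtained from the other by a sequence of these operations. -}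

module Defs where

open import Data.Bool using (Bool; true; false; not; _∧_; _∨_; _xor_; if_then_else_)
open import Data.Nat using (ℕ; zero; suc; _+_; _*_; _∸_; _<_; _⊔_; _<ᵇ_; _≤ᵇ_)
open import Data.Fin using (Fin; splitAt; _≟_)
open import Data.Sum using (inj₁; inj₂)
open import Data.List using (List; []; _∷_; _++_; map; foldr; allFin; filterᵇ)
open import Data.Bool.ListAction using (all; any)
open import Data.Vec using (Vec; []; _∷_; lookup)
open import Relation.Nullary.Decidable using (⌊_⌋)
open import Relation.Binary.PropositionalEquality using (_≡_)
open import Relation.Binary.Construct.Closure.ReflexiveTransitive using (Star)

-- Looped simple graphs on vertex set Fin n, as symmetric GF(2) adjacency
-- matrices A(G) (diagonal entry true iff the vertex is looped).

Mat : ℕ → Set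
Mat n = Fin n → Fin n → Bool

record Graph (n : ℕ) : Set where
  field
    adj : Mat n
    symmetric : ∀ i j → adj i j ≡ adj j i
open Graph public

eqᵇ : ∀ {n} → Fin n → Fin n → Bool
eqᵇ i j = ⌊ i ≟ j ⌋

nbrᵇ : ∀ {n} → Mat n → Fin n → Fin n → Bool
nbrᵇ A v w = not (eqᵇ v w) ∧ A v w

countᵇ : ∀ {n} → (Fin n → Bool) → ℕ
countᵇ {n} p = foldr (λ i acc → (if p i then 1 else 0) + acc) 0 (allFin n)

degree : ∀ {n} → Graph n → Fin n → ℕ
degree G v = countᵇ (nbrᵇ (adj G) v)

loopComp : ∀ {n} → Fin n → Mat n → Mat n
loopComp v A i j = if eqᵇ i v ∧ eqᵇ j v then not (A i j) else A i j

simpleLocComp : ∀ {n} → Fin n → Mat n → Mat n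
simpleLocComp v A i j =
  if not (eqᵇ i j) ∧ nbrᵇ A v i ∧ nbrᵇ A v j then not (A i j) else A i j

nonSimpleLocComp : ∀ {n} → Fin n → Mat n → Mat n
nonSimpleLocComp v A i j =
  if nbrᵇ A v i ∧ nbrᵇ A v j then not (A i j) else A i j

data LocStep {n : ℕ} : Mat n → Mat n → Set where
  loop      : ∀ v A → LocStep A (loopComp v A)
  simple    : ∀ v A → LocStep A (simpleLocComp v A)
  nonSimple : ∀ v A → LocStep A (nonSimpleLocComp v A)

LocallyEquivalent : ∀ {n} → Graph n → Graph n → Set
LocallyEquivalent G H = Star LocStep (adj G) (adj H)

-- Binary matroids represented by a GF(2) matrix with m columns in GF(2)^n.
-- Subsets of the ground set Fin m are Vec Bool m.

Subset : ℕ → Set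
Subset m = Vec Bool m

allSubsets : (m : ℕ) → List (Subset m)
allSubsets zero = [] ∷ []
allSubsets (suc m) = map (true ∷_) (allSubsets m) ++ map (false ∷_) (allSubsets m)

mem : ∀ {m} → Subset m → Fin m → Bool
mem S i = lookup S i

size : ∀ {m} → Subset m → ℕ
size S = countᵇ (mem S)

complement : ∀ {m} → Subset m → Subset m
complement [] = []
complement (b ∷ S) = not b ∷ complement S

full : ∀ m → Subset m
full zero = []
full (suc m) = true ∷ full m

subsetᵇ : ∀ {m} → Subset m → Subset m → Bool
subsetᵇ {m} U T = all (λ i → not (mem U i) ∨ mem T i) (allFin m)

GF2Vec : ℕ → Set
GF2Vec n = Fin n → Bool

sumCols : ∀ {n m} → (Fin m → GF2Vec n) → Subset m → GF2Vec n
sumCols {n} {m} col U r =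
  foldr (λ i acc → (mem U i ∧ col i r) xor acc) false (allFin m)

isZeroᵇ : ∀ {n} → GF2Vec n → Bool
isZeroᵇ {n} v = all (λ r → not (v r)) (allFin n)

independentᵇ : ∀ {n m} → (Fin m → GF2Vec n) → Subset m → Bool
independentᵇ {m = m} col T =
  all (λ U → not (subsetᵇ U T ∧ (0 <ᵇ size U)) ∨ not (isZeroᵇ (sumCols col U)))
      (allSubsets m)

maxList : List ℕ → ℕ
maxList = foldr _⊔_ 0

rank : ∀ {n m} → (Fin m → GF2Vec n) → Subset m → ℕ
rank {m = m} col S =
  maxList (map size (filterᵇ (λ T → subsetᵇ T S ∧ independentᵇ col T) (allSubsets m)))

rankM : ∀ {n m} → (Fin m → GF2Vec n) → ℕ
rankM {m = m} col = rank col (full m)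

connectivity : ∀ {n m} → (Fin m → GF2Vec n) → Subset m → ℕ
connectivity col S = rank col S + rank col (complement S) ∸ rankM col

verticalSepᵇ : ∀ {n m} → (Fin m → GF2Vec n) → ℕ → Subset m → Bool
verticalSepᵇ col k S =
  (connectivity col S <ᵇ k) ∧ (k ≤ᵇ rank col S) ∧ (k ≤ᵇ rank col (complement S))

hasVerticalSepᵇ : ∀ {n m} → (Fin m → GF2Vec n) → ℕ → Bool
hasVerticalSepᵇ {m = m} col k = any (verticalSepᵇ col k) (allSubsets m)

-- κ(M) = min ({k | M has a vertical k-separation} ∪ {r(M)}):
-- search k = 0,1,..., r(M)-1 for the first k with a vertical
-- k-separation, else return r(M).
kappaSearch : ∀ {n m} → (Fin m → GF2Vec n) → ℕ → ℕ → ℕ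
kappaSearch col k zero = rankM col
kappaSearch col k (suc fuel) =
  if hasVerticalSepᵇ col k then k else kappaSearch col (suc k) fuel

kappa : ∀ {n m} → (Fin m → GF2Vec n) → ℕ
kappa col = kappaSearch col 0 (rankM col)

-- M[IAS(G)]: columns of (I  A(G)  A(G)+I), ground set Fin (n + (n + n)).

IAScols : ∀ {n} → Graph n → Fin (n + (n + n)) → GF2Vec n
IAScols {n} G c r with splitAt n c
... | inj₁ j = eqᵇ r j
... | inj₂ c' with splitAt n c'
...   | inj₁ j = adj G r j
...   | inj₂ j = adj G r j xor eqᵇ r j

-- Since M[IAS(G)] contains the identity columns, r(M) = n, and M has a vertical separation of
-- order < n iff its columns split into two sets of rank < n, i.e. iff two nonzero functionals
-- f, g on GF(2)^n annihilate, between them, every column.  On the columns e_j, A_j, A_j + e_j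
-- this says that the supports of (f, fA) and (g, gA), read per vertex, are disjoint.  Local
-- complementation at v acts on these pairs by f ↦ f + (f · N(v)) e_v, so this property is
-- invariant under local equivalence.  A vertex v of degree d with 2d + 1 < n gives f = e_v and
-- a nonzero g with g = 0 on N[v] and gA = 0 on N(v), which are 2d + 1 linear conditions.
-- Conversely one of two disjoint supports has at most n/2 vertices, and complementing at
-- suitable vertices shrinks f until, in a locally equivalent graph, some closed neighbourhood
-- lies inside that support.

module Submission where

open import Defs
open import Data.Bool using (Bool; true; false; not; _∧_; _∨_; _xor_; if_then_else_; T; T?)
open import Data.Bool.ListAction using (all; any)
open import Data.Bool.Properties
  using (∧-comm; ∧-zeroʳ; ∧-identityʳ; ∨-identityʳ; ∨-zeroʳ; not-involutive; T-≡;
         xor-assoc; xor-comm; xor-same; xor-identityʳ; ∧-distribˡ-xor; ∧-distribʳ-xor)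
open import Data.Bool.Solver using (module xor-∧-Solver)
open import Data.Empty using (⊥-elim)
open import Data.Fin using (Fin; zero; suc; _≟_; splitAt; _↑ˡ_; _↑ʳ_)
open import Data.Fin.Properties using (suc-injective; splitAt-↑ˡ; splitAt-↑ʳ)
open import Data.List using (List; []; _∷_; _++_; map; foldr; tabulate; allFin; filterᵇ; length)
open import Data.List.Membership.Propositional using (_∈_)
open import Data.List.Membership.Propositional.Properties
  using (∈-map⁺; ∈-map⁻; ∈-++⁺ˡ; ∈-++⁺ʳ; ∈-filter⁺; ∈-filter⁻; ∈-allFin)
open import Data.List.Properties using (length-map; length-tabulate; length-++)
open import Data.List.Relation.Unary.All using (All; []; _∷_)
import Data.List.Relation.Unary.All as All
import Data.List.Relation.Unary.All.Properties as All
open import Data.List.Relation.Unary.Any using (here; there)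
open import Data.Nat using (ℕ; zero; suc; _+_; _*_; _∸_; _<_; _≤_; _<ᵇ_; _≤ᵇ_; z≤n; s≤s; >-nonZero)
open import Data.Nat.Properties
  using (module ≤-Reasoning; ≤-refl; ≤-reflexive; ≤-trans; ≤-antisym; ≤-total; ≤-pred; <-irrefl;
         <-trans; <-≤-trans; ≤-<-trans; ≮⇒≥; ≰⇒>; ≤∧≢⇒<; n<1+n; <ᵇ⇒<; <⇒<ᵇ; ≤ᵇ⇒≤; ≤⇒≤ᵇ;
         +-comm; +-suc; +-identityʳ; +-mono-≤; +-monoˡ-≤; +-monoʳ-≤; +-monoʳ-<; *-suc; *-monoʳ-≤;
         m≤n+m; +-∸-comm; m<n+o⇒m∸n<o; m≤m⊔n; m≤n⊔m; ⊔-sel)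
import Data.Nat.Properties as ℕ
open import Data.Nat.Tactic.RingSolver using (solve-∀)
open import Data.Product using (Σ; _×_; _,_; proj₁; proj₂)
open import Data.Sum using (_⊎_; inj₁; inj₂)
import Data.Vec as Vec
open import Data.Vec.Properties using (lookup∘tabulate)
open import Function using (_∘_; id; Equivalence)
open import Function.Bundles using (_⇔_; mk⇔)
open import Function.Properties.Equivalence using () renaming (trans to ⇔-trans)
open import Relation.Binary.Construct.Closure.ReflexiveTransitive using (Star; ε; _◅_)
open import Relation.Binary.PropositionalEquality
  using (_≡_; _≢_; refl; sym; trans; cong; cong₂; subst; subst₂; module ≡-Reasoning)
open import Relation.Nullary using (¬_)
open import Relation.Nullary.Decidable using (isYes≗does; dec-true; dec-false; toWitness)

open xor-∧-Solver using (solve; _:+_; _:*_; _:=_)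

_⊆_ : ∀ {m} → (Fin m → Bool) → (Fin m → Bool) → Set
u ⊆ t = ∀ i → u i ≡ true → t i ≡ true

Nonzero : ∀ {n} → GF2Vec n → Set
Nonzero {n} f = Σ (Fin n) λ r → f r ≡ true

true≢false : true ≢ false
true≢false ()

∧-split : ∀ {a b} → a ∧ b ≡ true → a ≡ true × b ≡ true
∧-split {true} {true} _ = refl , refl

∨-false : ∀ {a b} → a ∨ b ≡ false → a ≡ false × b ≡ false
∨-false {false} {false} _ = refl , refl

if-not≡xor : ∀ b x → (if b then not x else x) ≡ x xor b
if-not≡xor true  x = sym (xor-comm x true)
if-not≡xor false x = sym (xor-identityʳ x)

eqᵇ-refl : ∀ {n} (i : Fin n) → eqᵇ i i ≡ true
eqᵇ-refl i = trans (isYes≗does (i ≟ i)) (dec-true (i ≟ i) refl)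

≢⇒eqᵇ-false : ∀ {n} {i j : Fin n} → i ≢ j → eqᵇ i j ≡ false
≢⇒eqᵇ-false {i = i} {j} i≢j = trans (isYes≗does (i ≟ j)) (dec-false (i ≟ j) i≢j)

eqᵇ⇒≡ : ∀ {n} {i j : Fin n} → eqᵇ i j ≡ true → i ≡ j
eqᵇ⇒≡ e = toWitness (subst T (sym e) _)

eqᵇ-suc : ∀ {n} (i j : Fin n) → eqᵇ (suc i) (suc j) ≡ eqᵇ i j
eqᵇ-suc i j = trans (isYes≗does (suc i ≟ suc j)) (sym (isYes≗does (i ≟ j)))

eqᵇ-sym : ∀ {n} (i j : Fin n) → eqᵇ i j ≡ eqᵇ j i
eqᵇ-sym i j with eqᵇ i j in e
... | true  = sym (trans (cong (eqᵇ j) (eqᵇ⇒≡ e)) (eqᵇ-refl j))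
... | false = sym (≢⇒eqᵇ-false λ { refl → true≢false (trans (sym (eqᵇ-refl i)) e) })

-- Counting and GF(2) sums over Fin n

indicator : Bool → ℕ
indicator b = if b then 1 else 0

count : ∀ {n} → (Fin n → Bool) → ℕ
count {zero}  p = 0
count {suc n} p = indicator (p zero) + count (p ∘ suc)

⨁ : ∀ {n} → (Fin n → Bool) → Bool
⨁ {zero}  p = false
⨁ {suc n} p = p zero xor ⨁ (p ∘ suc)

find : ∀ {n} (p : Fin n → Bool) → Nonzero p ⊎ (∀ i → p i ≡ false)
find {zero}  p = inj₂ λ ()
find {suc n} p with p zero in e | find (p ∘ suc)
... | true  | _              = inj₁ (zero , e)
... | false | inj₁ (i , pi) = inj₁ (suc i , pi)
... | false | inj₂ none     = inj₂ λ { zero → e ; (suc i) → none i }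

count-cong : ∀ {n} {p q : Fin n → Bool} → (∀ i → p i ≡ q i) → count p ≡ count q
count-cong {zero}  p≗q = refl
count-cong {suc n} p≗q =
  cong₂ _+_ (cong indicator (p≗q zero)) (count-cong (p≗q ∘ suc))

⨁-cong : ∀ {n} {p q : Fin n → Bool} → (∀ i → p i ≡ q i) → ⨁ p ≡ ⨁ q
⨁-cong {zero}  p≗q = refl
⨁-cong {suc n} p≗q = cong₂ _xor_ (p≗q zero) (⨁-cong (p≗q ∘ suc))

count-tabulate : ∀ {A : Set} {n} (p : A → Bool) (g : Fin n → A) →
  foldr (λ x acc → (if p x then 1 else 0) + acc) 0 (tabulate g) ≡ count (p ∘ g)
count-tabulate {n = zero}  p g = refl
count-tabulate {n = suc n} p g =
  cong (indicator (p (g zero)) +_) (count-tabulate p (g ∘ suc))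

countᵇ≡count : ∀ {n} (p : Fin n → Bool) → countᵇ p ≡ count p
countᵇ≡count p = count-tabulate p id

length-filterᵇ-tabulate : ∀ {A : Set} {n} (p : A → Bool) (g : Fin n → A) →
  length (filterᵇ p (tabulate g)) ≡ count (p ∘ g)
length-filterᵇ-tabulate {n = zero}  p g = refl
length-filterᵇ-tabulate {n = suc n} p g with p (g zero)
... | true  = cong suc (length-filterᵇ-tabulate p (g ∘ suc))
... | false = length-filterᵇ-tabulate p (g ∘ suc)

count-mono : ∀ {n} {p q : Fin n → Bool} → p ⊆ q → count p ≤ count q
count-mono {zero}  p⊆q = z≤n
count-mono {suc n} {p} {q} p⊆q = +-mono-≤ (head (p zero) (q zero) (p⊆q zero)) (count-mono (p⊆q ∘ suc))
  where
  head : ∀ a b → (a ≡ true → b ≡ true) → indicator a ≤ indicator b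
  head true  b a⇒b rewrite a⇒b refl = ≤-refl
  head false b a⇒b = z≤n

count-disjoint : ∀ {n} (p q : Fin n → Bool) → (∀ i → p i ∧ q i ≡ false) → count p + count q ≤ n
count-disjoint {zero}  p q disj = z≤n
count-disjoint {suc n} p q disj = begin
  (a + count (p ∘ suc)) + (b + count (q ∘ suc)) ≡⟨ interchange a (count (p ∘ suc)) b (count (q ∘ suc)) ⟩
  (a + b) + (count (p ∘ suc) + count (q ∘ suc)) ≤⟨ +-mono-≤ (head (p zero) (q zero) (disj zero))
                                                            (count-disjoint (p ∘ suc) (q ∘ suc) (disj ∘ suc)) ⟩
  suc n                                         ∎
  where
  open ≤-Reasoning
  a b : ℕ
  a = indicator (p zero)
  b = indicator (q zero)
  interchange : ∀ w x y z → (w + x) + (y + z) ≡ (w + y) + (x + z)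
  interchange = solve-∀
  head : ∀ x y → x ∧ y ≡ false → indicator x + indicator y ≤ 1
  head true  false _ = ≤-refl
  head false true  _ = ≤-refl
  head false false _ = z≤n

count-none : ∀ {n} (p : Fin n → Bool) → (∀ i → p i ≡ false) → count p ≡ 0
count-none {zero}  p none = refl
count-none {suc n} p none rewrite none zero = count-none (p ∘ suc) (none ∘ suc)

count-all : ∀ n → count {n} (λ _ → true) ≡ n
count-all zero    = refl
count-all (suc n) = cong suc (count-all n)

remove : ∀ {n} → (Fin n → Bool) → Fin n → (Fin n → Bool)
remove p j i = p i ∧ not (eqᵇ i j)

count-remove : ∀ {n} (p : Fin n → Bool) j → p j ≡ true → count p ≡ suc (count (remove p j))
count-remove {suc n} p zero pj rewrite pj =
  cong suc (count-cong (λ i → sym (∧-identityʳ (p (suc i)))))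
count-remove {suc n} p (suc j) pj = begin
  a + count (p ∘ suc)                        ≡⟨ cong (a +_) (count-remove (p ∘ suc) j pj) ⟩
  a + suc (count (remove (p ∘ suc) j))       ≡⟨ +-suc a (count (remove (p ∘ suc) j)) ⟩
  suc (a + count (remove (p ∘ suc) j))       ≡⟨ cong suc (cong₂ _+_ (cong indicator (sym (∧-identityʳ (p zero))))
                                                  (count-cong (λ i → cong (λ b → p (suc i) ∧ not b) (sym (eqᵇ-suc i j))))) ⟩
  suc (count (remove p (suc j)))             ∎
  where
  open ≡-Reasoning
  a : ℕ
  a = indicator (p zero)

count-pos⇒Nonzero : ∀ {n} (p : Fin n → Bool) → 0 < count p → Nonzero p
count-pos⇒Nonzero p pos with find p
... | inj₁ w    = w
... | inj₂ none with () ← subst (0 <_) (count-none p none) pos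

Nonzero⇒count-pos : ∀ {n} (p : Fin n → Bool) → Nonzero p → 0 < count p
Nonzero⇒count-pos p (j , pj) rewrite count-remove p j pj = s≤s z≤n

⨁-tabulate : ∀ {A : Set} {n} (h : A → Bool) (g : Fin n → A) →
  foldr (λ x acc → h x xor acc) false (tabulate g) ≡ ⨁ (h ∘ g)
⨁-tabulate {n = zero}  h g = refl
⨁-tabulate {n = suc n} h g = cong (h (g zero) xor_) (⨁-tabulate h (g ∘ suc))

⨁-none : ∀ {n} (p : Fin n → Bool) → (∀ i → p i ≡ false) → ⨁ p ≡ false
⨁-none {zero}  p none = refl
⨁-none {suc n} p none rewrite none zero = ⨁-none (p ∘ suc) (none ∘ suc)

⨁-true⇒Nonzero : ∀ {n} (p : Fin n → Bool) → ⨁ p ≡ true → Nonzero p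
⨁-true⇒Nonzero p sum with find p
... | inj₁ w    = w
... | inj₂ none = ⊥-elim (true≢false (trans (sym sum) (⨁-none p none)))

⨁-xor : ∀ {n} (p q : Fin n → Bool) → ⨁ (λ i → p i xor q i) ≡ ⨁ p xor ⨁ q
⨁-xor {zero}  p q = refl
⨁-xor {suc n} p q =
  trans (cong ((p zero xor q zero) xor_) (⨁-xor (p ∘ suc) (q ∘ suc)))
        (interchange (p zero) (q zero) (⨁ (p ∘ suc)) (⨁ (q ∘ suc)))
  where
  interchange : ∀ a b c d → (a xor b) xor (c xor d) ≡ (a xor c) xor (b xor d)
  interchange = solve 4 (λ a b c d → (a :+ b) :+ (c :+ d) := (a :+ c) :+ (b :+ d)) refl

⨁-∧ˡ : ∀ {n} b (p : Fin n → Bool) → ⨁ (λ i → b ∧ p i) ≡ b ∧ ⨁ p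
⨁-∧ˡ true  p = refl
⨁-∧ˡ {n} false p = ⨁-none {n} (λ _ → false) (λ _ → refl)

⨁-swap : ∀ {n m} (h : Fin n → Fin m → Bool) →
  ⨁ (λ i → ⨁ (λ r → h i r)) ≡ ⨁ (λ r → ⨁ (λ i → h i r))
⨁-swap {zero}  {m} h = sym (⨁-none {m} (λ _ → false) (λ _ → refl))
⨁-swap {suc n}     h =
  trans (cong (⨁ (h zero) xor_) (⨁-swap (h ∘ suc)))
        (sym (⨁-xor (h zero) (λ r → ⨁ (λ i → h (suc i) r))))

⨁-single : ∀ {n} (p : Fin n → Bool) s → (∀ i → i ≢ s → p i ≡ false) → ⨁ p ≡ p s
⨁-single p zero off =
  trans (cong (p zero xor_) (⨁-none (p ∘ suc) (λ i → off (suc i) λ ()))) (xor-identityʳ (p zero))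
⨁-single p (suc s) off =
  trans (cong (_xor ⨁ (p ∘ suc)) (off zero λ ()))
        (⨁-single (p ∘ suc) s (λ i i≢s → off (suc i) (i≢s ∘ suc-injective)))

⨁-delta : ∀ {n} (f : Fin n → Bool) j → ⨁ (λ i → f i ∧ eqᵇ i j) ≡ f j
⨁-delta f j =
  trans (⨁-single _ j (λ i i≢j → trans (cong (f i ∧_) (≢⇒eqᵇ-false i≢j)) (∧-zeroʳ (f i))))
        (trans (cong (f j ∧_) (eqᵇ-refl j)) (∧-identityʳ (f j)))

module _ {A : Set} (P : A → Bool) where

  all⁻ : ∀ {xs x} → all P xs ≡ true → x ∈ xs → P x ≡ true
  all⁻ e (here refl) = proj₁ (∧-split e)
  all⁻ e (there x∈)  = all⁻ (proj₂ (∧-split e)) x∈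

  all⁺ : ∀ xs → (∀ x → P x ≡ true) → all P xs ≡ true
  all⁺ []       every = refl
  all⁺ (y ∷ xs) every rewrite every y = all⁺ xs every

  all-false⁻ : ∀ xs → all P xs ≡ false → Σ A λ x → P x ≡ false
  all-false⁻ (y ∷ xs) e with P y in Py
  ... | false = y , Py
  ... | true  = all-false⁻ xs e

  any⁺ : ∀ {xs x} → x ∈ xs → P x ≡ true → any P xs ≡ true
  any⁺ (here refl) Px rewrite Px = refl
  any⁺ {y ∷ _} (there x∈) Px with P y
  ... | true  = refl
  ... | false = any⁺ x∈ Px

  any⁻ : ∀ xs → any P xs ≡ true → Σ A λ x → P x ≡ true
  any⁻ (y ∷ xs) e with P y in Py
  ... | true  = y , Py
  ... | false = any⁻ xs e

  ∈-filterᵇ⁺ : ∀ {xs x} → x ∈ xs → P x ≡ true → x ∈ filterᵇ P xs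
  ∈-filterᵇ⁺ x∈ Px = ∈-filter⁺ (T? ∘ P) x∈ (Equivalence.from T-≡ Px)

  ∈-filterᵇ⁻ : ∀ {xs x} → x ∈ filterᵇ P xs → P x ≡ true
  ∈-filterᵇ⁻ {xs} x∈ = Equivalence.to T-≡ (proj₂ (∈-filter⁻ (T? ∘ P) {xs = xs} x∈))

maxList-upper : ∀ {x} xs → x ∈ xs → x ≤ maxList xs
maxList-upper (y ∷ xs) (here refl) = m≤m⊔n y (maxList xs)
maxList-upper (y ∷ xs) (there x∈)  = ≤-trans (maxList-upper xs x∈) (m≤n⊔m y (maxList xs))

maxList-attained : ∀ xs → maxList xs ≡ 0 ⊎ maxList xs ∈ xs
maxList-attained []       = inj₁ refl
maxList-attained (y ∷ xs) with ⊔-sel y (maxList xs) | maxList-attained xs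
... | inj₁ y⊔≡y | _          = inj₂ (here y⊔≡y)
... | inj₂ y⊔≡m | inj₁ m≡0   = inj₁ (trans y⊔≡m m≡0)
... | inj₂ y⊔≡m | inj₂ m∈    = inj₂ (there (subst (_∈ xs) (sym y⊔≡m) m∈))

∈-allSubsets : ∀ {m} (S : Subset m) → S ∈ allSubsets m
∈-allSubsets Vec.[]            = here refl
∈-allSubsets {suc m} (true Vec.∷ S)  = ∈-++⁺ˡ (∈-map⁺ (true Vec.∷_) (∈-allSubsets S))
∈-allSubsets {suc m} (false Vec.∷ S) =
  ∈-++⁺ʳ (map (true Vec.∷_) (allSubsets m)) (∈-map⁺ (false Vec.∷_) (∈-allSubsets S))

<ᵇ-true : ∀ {m n} → m < n → (m <ᵇ n) ≡ true
<ᵇ-true m<n = Equivalence.to T-≡ (<⇒<ᵇ m<n)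

<ᵇ-true⁻ : ∀ {m n} → (m <ᵇ n) ≡ true → m < n
<ᵇ-true⁻ e = <ᵇ⇒< _ _ (Equivalence.from T-≡ e)

≤ᵇ-true : ∀ {m n} → m ≤ n → (m ≤ᵇ n) ≡ true
≤ᵇ-true m≤n = Equivalence.to T-≡ (≤⇒≤ᵇ m≤n)

≤ᵇ-true⁻ : ∀ {m n} → (m ≤ᵇ n) ≡ true → m ≤ n
≤ᵇ-true⁻ e = ≤ᵇ⇒≤ _ _ (Equivalence.from T-≡ e)

-- Homogeneous linear systems over GF(2)

infix 7 _·_

_·_ : ∀ {n} → GF2Vec n → GF2Vec n → Bool
f · v = ⨁ (λ r → f r ∧ v r)

·-comm : ∀ {n} (f g : GF2Vec n) → f · g ≡ g · f
·-comm f g = ⨁-cong (λ r → ∧-comm (f r) (g r))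

·-xorˡ : ∀ {n} (u v e : GF2Vec n) → (λ i → u i xor v i) · e ≡ u · e xor v · e
·-xorˡ u v e =
  trans (⨁-cong (λ i → ∧-distribʳ-xor (e i) (u i) (v i))) (⨁-xor (λ i → u i ∧ e i) (λ i → v i ∧ e i))

·-xorʳ : ∀ {n} (u a b : GF2Vec n) → u · (λ i → a i xor b i) ≡ u · a xor u · b
·-xorʳ u a b =
  trans (⨁-cong (λ i → ∧-distribˡ-xor (u i) (a i) (b i))) (⨁-xor (λ i → u i ∧ a i) (λ i → u i ∧ b i))

·-scaleʳ : ∀ {n} (u e : GF2Vec n) k → u · (λ i → k ∧ e i) ≡ k ∧ u · e
·-scaleʳ u e k = trans (⨁-cong (λ i → swap (u i) k (e i))) (⨁-∧ˡ k (λ i → u i ∧ e i))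
  where
  swap : ∀ x k y → x ∧ (k ∧ y) ≡ k ∧ (x ∧ y)
  swap = solve 3 (λ x k y → x :* (k :* y) := k :* (x :* y)) refl

·-unitˡ : ∀ {n} (e : GF2Vec n) j c → (λ i → eqᵇ i j ∧ c) · e ≡ c ∧ e j
·-unitˡ e j c = trans (⨁-cong (λ i → swap (eqᵇ i j) c (e i))) (⨁-delta (λ i → c ∧ e i) j)
  where
  swap : ∀ x c y → (x ∧ c) ∧ y ≡ (c ∧ y) ∧ x
  swap = solve 3 (λ x c y → (x :* c) :* y := (c :* y) :* x) refl

·-unitʳ : ∀ {n} (f v : GF2Vec n) r → (∀ r′ → v r′ ≡ eqᵇ r′ r) → f · v ≡ f r
·-unitʳ f v r v≡eᵣ = trans (⨁-cong (λ r′ → cong (f r′ ∧_) (v≡eᵣ r′))) (⨁-delta f r)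

eliminateAt : ∀ {m} → Fin m → (Fin m → Bool) → (Fin m → Bool) → (Fin m → Bool)
eliminateAt i₀ e e′ i = e′ i xor (e′ i₀ ∧ e i)

NontrivialSolution : ∀ {m} → (Fin m → Bool) → List (Fin m → Bool) → Set
NontrivialSolution {m} t E = Σ (Fin m → Bool) λ u → u ⊆ t × 0 < count u × All (λ e → u · e ≡ false) E

solution-skip : ∀ {m} (t e : Fin m → Bool) {E} → (∀ i → t i ∧ e i ≡ false) →
  NontrivialSolution t E → NontrivialSolution t (e ∷ E)
solution-skip t e t∩e≡∅ (u , u⊆t , pos , sol) = u , u⊆t , pos , ⨁-none _ vanish ∷ sol
  where
  vanish : ∀ i → u i ∧ e i ≡ false
  vanish i with u i in ui
  ... | false = refl
  ... | true  = trans (cong (_∧ e i) (sym (u⊆t i ui))) (t∩e≡∅ i)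

-- Gaussian elimination on the pivot i₀ of e: solve the reduced system without the
-- variable i₀, then choose the value of i₀ so that the equation e holds.
solution-pivot : ∀ {m} (t e : Fin m → Bool) (E : List (Fin m → Bool)) i₀ → t i₀ ≡ true → e i₀ ≡ true →
  NontrivialSolution (remove t i₀) (map (eliminateAt i₀ e) E) →
  NontrivialSolution t (e ∷ E)
solution-pivot {m} t e E i₀ ti₀ ei₀ (u′ , u′⊆t′ , pos′ , sol′) = u , u⊆t , pos , sol-e ∷ sol-E
  where
  c : Bool
  c = u′ · e
  u : Fin m → Bool
  u i = u′ i xor (eqᵇ i i₀ ∧ c)
  u⊆t : u ⊆ t
  u⊆t i ui with u′ i in u′i | eqᵇ i i₀ in i≟i₀
  ... | true  | _     = proj₁ (∧-split (u′⊆t′ i u′i))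
  ... | false | true  = subst (λ k → t k ≡ true) (sym (eqᵇ⇒≡ i≟i₀)) ti₀
  ... | false | false = ⊥-elim (true≢false (sym ui))
  pos : 0 < count u
  pos = let j , u′j = count-pos⇒Nonzero u′ pos′
        in Nonzero⇒count-pos u (j , off-pivot u′j (proj₂ (∧-split (u′⊆t′ j u′j))))
    where
    off-pivot : ∀ {a b} → a ≡ true → not b ≡ true → a xor (b ∧ c) ≡ true
    off-pivot {true} {false} _ _ = refl
  sol-e : u · e ≡ false
  sol-e = begin
    u · e                           ≡⟨ ·-xorˡ u′ (λ i → eqᵇ i i₀ ∧ c) e ⟩
    c xor (λ i → eqᵇ i i₀ ∧ c) · e  ≡⟨ cong (c xor_) (·-unitˡ e i₀ c) ⟩
    c xor (c ∧ e i₀)                ≡⟨ cong (λ b → c xor (c ∧ b)) ei₀ ⟩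
    c xor (c ∧ true)                ≡⟨ cong (c xor_) (∧-identityʳ c) ⟩
    c xor c                         ≡⟨ xor-same c ⟩
    false                           ∎
    where open ≡-Reasoning
  sol-E : All (λ e′ → u · e′ ≡ false) E
  sol-E = All.map (λ {e′} reduced → begin
    u · e′                                    ≡⟨ ·-xorˡ u′ (λ i → eqᵇ i i₀ ∧ c) e′ ⟩
    u′ · e′ xor (λ i → eqᵇ i i₀ ∧ c) · e′     ≡⟨ cong (u′ · e′ xor_) (·-unitˡ e′ i₀ c) ⟩
    u′ · e′ xor (c ∧ e′ i₀)                   ≡⟨ cong (u′ · e′ xor_) (∧-comm c (e′ i₀)) ⟩
    u′ · e′ xor (e′ i₀ ∧ c)                   ≡⟨ cong (u′ · e′ xor_) (sym (·-scaleʳ u′ e (e′ i₀))) ⟩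
    u′ · e′ xor u′ · (λ i → e′ i₀ ∧ e i)      ≡⟨ sym (·-xorʳ u′ e′ (λ i → e′ i₀ ∧ e i)) ⟩
    u′ · (λ i → e′ i xor (e′ i₀ ∧ e i))       ≡⟨ reduced ⟩
    false                                     ∎) (All.map⁻ sol′)
    where open ≡-Reasoning

nontrivial-solution : ∀ {m} (E : List (Fin m → Bool)) (t : Fin m → Bool) → length E < count t →
  NontrivialSolution t E
nontrivial-solution E = eliminate (length E) E refl
  where
  eliminate : ∀ {m} k (E : List (Fin m → Bool)) → length E ≡ k → ∀ t → length E < count t →
    NontrivialSolution t E
  eliminate _ [] _ t pos = t , (λ _ → id) , pos , []
  eliminate (suc k) (e ∷ E) |E|≡1+k t |E|<t with find (λ i → t i ∧ e i)
  ... | inj₂ t∩e≡∅ =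
    solution-skip t e t∩e≡∅ (eliminate k E (ℕ.suc-injective |E|≡1+k) t (<-trans (n<1+n _) |E|<t))
  ... | inj₁ (i₀ , ti₀∧ei₀) with ∧-split ti₀∧ei₀
  ...   | ti₀ , ei₀ =
    solution-pivot t e E i₀ ti₀ ei₀ (eliminate k E′ |E′|≡k (remove t i₀) |E′|<t′)
    where
    E′ : List (Fin _ → Bool)
    E′ = map (eliminateAt i₀ e) E
    |E′|≡k : length E′ ≡ k
    |E′|≡k = trans (length-map (eliminateAt i₀ e) E) (ℕ.suc-injective |E|≡1+k)
    |E′|<t′ : length E′ < count (remove t i₀)
    |E′|<t′ = subst (_< count (remove t i₀)) (sym (length-map (eliminateAt i₀ e) E))
                (≤-pred (subst (suc (length E) <_) (count-remove t i₀ ti₀) |E|<t))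

-- Independence and rank of a family of columns

combination : ∀ {n m} → (Fin m → GF2Vec n) → (Fin m → Bool) → GF2Vec n
combination col u r = u · (λ i → col i r)

·-combination : ∀ {n m} (col : Fin m → GF2Vec n) (f : GF2Vec n) u →
  f · combination col u ≡ u · (λ i → f · col i)
·-combination col f u = begin
  ⨁ (λ r → f r ∧ ⨁ (λ i → u i ∧ col i r))   ≡⟨ sym (⨁-cong (λ r → ⨁-∧ˡ (f r) (λ i → u i ∧ col i r))) ⟩
  ⨁ (λ r → ⨁ (λ i → f r ∧ (u i ∧ col i r)))  ≡⟨ ⨁-swap (λ r i → f r ∧ (u i ∧ col i r)) ⟩
  ⨁ (λ i → ⨁ (λ r → f r ∧ (u i ∧ col i r)))  ≡⟨ ⨁-cong (λ i → trans (⨁-cong (λ r → swap (f r) (u i) (col i r)))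
                                                                    (⨁-∧ˡ (u i) (λ r → f r ∧ col i r))) ⟩
  ⨁ (λ i → u i ∧ f · col i)                  ∎
  where
  open ≡-Reasoning
  swap : ∀ x y z → x ∧ (y ∧ z) ≡ y ∧ (x ∧ z)
  swap = solve 3 (λ x y z → x :* (y :* z) := y :* (x :* z)) refl

Independent : ∀ {n m} → (Fin m → GF2Vec n) → (Fin m → Bool) → Set
Independent col t = ∀ u → u ⊆ t → 0 < count u → Nonzero (combination col u)

∅ : ∀ {m} → Fin m → Bool
∅ _ = false

∅-independent : ∀ {n m} (col : Fin m → GF2Vec n) → Independent col ∅
∅-independent col u u⊆∅ pos = let i , ui = count-pos⇒Nonzero u pos in ⊥-elim (true≢false (sym (u⊆∅ i ui)))

toSubset : ∀ {m} → (Fin m → Bool) → Subset m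
toSubset = Vec.tabulate

mem-toSubset : ∀ {m} (p : Fin m → Bool) i → mem (toSubset p) i ≡ p i
mem-toSubset = lookup∘tabulate

⊆-toSubset⁺ : ∀ {m} {u t : Fin m → Bool} → u ⊆ t → u ⊆ mem (toSubset t)
⊆-toSubset⁺ {t = t} u⊆t i ui = trans (mem-toSubset t i) (u⊆t i ui)

⊆-toSubset⁻ : ∀ {m} {u t : Fin m → Bool} → u ⊆ mem (toSubset t) → u ⊆ t
⊆-toSubset⁻ {t = t} u⊆T i ui = trans (sym (mem-toSubset t i)) (u⊆T i ui)

toSubset-⊆⁺ : ∀ {m} {t : Fin m → Bool} {S} → t ⊆ S → mem (toSubset t) ⊆ S
toSubset-⊆⁺ {t = t} t⊆S i Ti = t⊆S i (trans (sym (mem-toSubset t i)) Ti)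

size≡count : ∀ {m} (S : Subset m) → size S ≡ count (mem S)
size≡count S = countᵇ≡count (mem S)

size-toSubset : ∀ {m} (p : Fin m → Bool) → size (toSubset p) ≡ count p
size-toSubset p = trans (size≡count (toSubset p)) (count-cong (mem-toSubset p))

sumCols≡combination : ∀ {n m} (col : Fin m → GF2Vec n) (U : Subset m) r →
  sumCols col U r ≡ combination col (mem U) r
sumCols≡combination col U r = ⨁-tabulate (λ i → mem U i ∧ col i r) id

subsetᵇ-sound : ∀ {m} {U T : Subset m} → subsetᵇ U T ≡ true → mem U ⊆ mem T
subsetᵇ-sound {m} {U} {T} e i = implication (mem U i) (all⁻ _ e (∈-allFin i))
  where
  implication : ∀ a {b} → not a ∨ b ≡ true → a ≡ true → b ≡ true
  implication true ¬a∨b refl = ¬a∨b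

subsetᵇ-complete : ∀ {m} {U T : Subset m} → mem U ⊆ mem T → subsetᵇ U T ≡ true
subsetᵇ-complete {m} {U} {T} U⊆T = all⁺ _ (allFin m) λ i → implication (mem U i) (U⊆T i)
  where
  implication : ∀ a {b} → (a ≡ true → b ≡ true) → not a ∨ b ≡ true
  implication true  a⇒b = a⇒b refl
  implication false a⇒b = refl

isZeroᵇ-sound : ∀ {n} {v : GF2Vec n} → isZeroᵇ v ≡ true → ∀ r → v r ≡ false
isZeroᵇ-sound {v = v} e r = not-true (all⁻ _ e (∈-allFin r))
  where
  not-true : ∀ {a} → not a ≡ true → a ≡ false
  not-true {false} _ = refl

isZeroᵇ-false : ∀ {n} (v : GF2Vec n) → isZeroᵇ v ≡ false → Nonzero v
isZeroᵇ-false {n} v e = let r , ¬vr = all-false⁻ _ (allFin n) e in r , not-false ¬vr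
  where
  not-false : ∀ {a} → not a ≡ false → a ≡ true
  not-false {true} _ = refl

module _ {n m : ℕ} (col : Fin m → GF2Vec n) where

  private
    NoDependency : Subset m → Subset m → Bool
    NoDependency T U = not (subsetᵇ U T ∧ (0 <ᵇ size U)) ∨ not (isZeroᵇ (sumCols col U))

    dependency-free : ∀ {a b c} → not (a ∧ b) ∨ not c ≡ true → a ≡ true → b ≡ true → c ≡ false
    dependency-free {c = false} _ _ _ = refl
    dependency-free {true} {true} {true} () _ _

    dependency : ∀ {a b c} → not (a ∧ b) ∨ not c ≡ false → a ≡ true × b ≡ true × c ≡ true
    dependency {true} {true} {true} _ = refl , refl , refl

  independentᵇ-sound : ∀ T → independentᵇ col T ≡ true → Independent col (mem T)
  independentᵇ-sound T indep u u⊆T pos =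
    r , trans (combination-cong r) (trans (sym (sumCols≡combination col U r)) Ur)
    where
    U : Subset m
    U = toSubset u
    combination-cong : ∀ r → combination col u r ≡ combination col (mem U) r
    combination-cong r = ⨁-cong (λ i → cong (_∧ col i r) (sym (mem-toSubset u i)))
    nonzero : isZeroᵇ (sumCols col U) ≡ false
    nonzero = dependency-free (all⁻ (NoDependency T) indep (∈-allSubsets U))
      (subsetᵇ-complete {U = U} {T} (toSubset-⊆⁺ u⊆T))
      (<ᵇ-true (subst (0 <_) (sym (size-toSubset u)) pos))
    r : Fin n
    r = proj₁ (isZeroᵇ-false (sumCols col U) nonzero)
    Ur : sumCols col U r ≡ true
    Ur = proj₂ (isZeroᵇ-false (sumCols col U) nonzero)

  independentᵇ-complete : ∀ T → Independent col (mem T) → independentᵇ col T ≡ true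
  independentᵇ-complete T indep = all⁺ (NoDependency T) (allSubsets m) each
    where
    each : ∀ U → NoDependency T U ≡ true
    each U with subsetᵇ U T in U⊆T | 0 <ᵇ size U in pos
    ... | false | _     = refl
    ... | true  | false = refl
    ... | true  | true  with isZeroᵇ (sumCols col U) in zero?
    ... | false = refl
    ... | true  =
      let r , Ur = indep (mem U) (subsetᵇ-sound {U = U} {T} U⊆T) (subst (0 <_) (size≡count U) (<ᵇ-true⁻ pos))
      in ⊥-elim (true≢false (trans (sym Ur)
           (trans (sym (sumCols≡combination col U r)) (isZeroᵇ-sound zero? r))))

  independentᵇ-false : ∀ T → independentᵇ col T ≡ false →
    Σ (Fin m → Bool) λ u → u ⊆ mem T × 0 < count u × (∀ r → combination col u r ≡ false)
  independentᵇ-false T e with all-false⁻ (NoDependency T) (allSubsets m) e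
  ... | U , free with dependency free
  ... | U⊆T , pos , zero? =
    mem U , subsetᵇ-sound {U = U} {T} U⊆T , subst (0 <_) (size≡count U) (<ᵇ-true⁻ pos) ,
    λ r → trans (sym (sumCols≡combination col U r)) (isZeroᵇ-sound zero? r)

  count≤rank : ∀ {t} S → Independent col t → t ⊆ mem S → count t ≤ rank col S
  count≤rank {t} S indep t⊆S =
    subst (_≤ rank col S) (size-toSubset t)
      (maxList-upper _ (∈-map⁺ size (∈-filterᵇ⁺ _ (∈-allSubsets (toSubset t)) admissible)))
    where
    admissible : subsetᵇ (toSubset t) S ∧ independentᵇ col (toSubset t) ≡ true
    admissible rewrite subsetᵇ-complete {U = toSubset t} {S} (toSubset-⊆⁺ t⊆S) =
      independentᵇ-complete (toSubset t) λ u u⊆T → indep u (⊆-toSubset⁻ u⊆T)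

  rank-attained : ∀ S → Σ (Fin m → Bool) λ t → Independent col t × t ⊆ mem S × count t ≡ rank col S
  rank-attained S with maxList-attained (map size (filterᵇ (λ T → subsetᵇ T S ∧ independentᵇ col T) (allSubsets m)))
  ... | inj₁ rank≡0 = ∅ , ∅-independent col , (λ _ ()) , trans (count-none (∅ {m}) (λ _ → refl)) (sym rank≡0)
  ... | inj₂ rank∈ with ∈-map⁻ size rank∈
  ... | T , T∈ , rank≡ with ∧-split (∈-filterᵇ⁻ (λ T → subsetᵇ T S ∧ independentᵇ col T) {allSubsets m} T∈)
  ... | T⊆S , indep =
    mem T , independentᵇ-sound T indep , subsetᵇ-sound {U = T} {S} T⊆S , trans (sym (size≡count T)) (sym rank≡)

independent⇒count≤dim : ∀ {n m} (col : Fin m → GF2Vec n) {t} → Independent col t → count t ≤ n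
independent⇒count≤dim {n} {m} col {t} indep = ≮⇒≥ n≮t
  where
  rows : List (Fin m → Bool)
  rows = map (λ r i → col i r) (allFin n)
  |rows|≡n : length rows ≡ n
  |rows|≡n = trans (length-map _ (allFin n)) (length-tabulate id)
  n≮t : ¬ n < count t
  n≮t n<t = let u , u⊆t , pos , sol = nontrivial-solution rows t (subst (_< count t) (sym |rows|≡n) n<t)
                r , ur = indep u u⊆t pos
            in true≢false (trans (sym ur) (All.lookup sol (∈-map⁺ _ (∈-allFin r))))

rank≤dim : ∀ {n m} (col : Fin m → GF2Vec n) S → rank col S ≤ n
rank≤dim col S = let t , indep , _ , t≡rank = rank-attained col S
                 in subst (_≤ _) t≡rank (independent⇒count≤dim col indep)

insert : ∀ {m} → (Fin m → Bool) → Fin m → (Fin m → Bool)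
insert t s i = t i ∨ eqᵇ i s

count-insert : ∀ {m} (t : Fin m → Bool) s → t s ≡ false → count (insert t s) ≡ suc (count t)
count-insert t s ts≡false =
  trans (count-remove (insert t s) s (trans (cong (t s ∨_) (eqᵇ-refl s)) (∨-zeroʳ (t s))))
        (cong suc (count-cong removed))
  where
  removed : ∀ i → remove (insert t s) s i ≡ t i
  removed i with eqᵇ i s in i≟s
  ... | false = trans (∧-identityʳ _) (∨-identityʳ (t i))
  ... | true rewrite eqᵇ⇒≡ i≟s | ts≡false = refl

⊆-insert⁻ : ∀ {m} {u t : Fin m → Bool} {s} → u ⊆ insert t s → u s ≡ false → u ⊆ t
⊆-insert⁻ {t = t} {s} u⊆t+s us≡false i ui with eqᵇ i s in i≟s
... | false = trans (sym (∨-identityʳ (t i))) (subst (λ b → t i ∨ b ≡ true) i≟s (u⊆t+s i ui))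
... | true  rewrite eqᵇ⇒≡ i≟s = ⊥-elim (true≢false (trans (sym ui) us≡false))

Annihilates : ∀ {n m} → GF2Vec n → (Fin m → GF2Vec n) → (Fin m → Bool) → Set
Annihilates f col t = ∀ i → t i ≡ true → f · col i ≡ false

module _ {n m : ℕ} (col : Fin m → GF2Vec n) {f : GF2Vec n} {t : Fin m → Bool}
         (f⊥t : Annihilates f col t) where

  ·-combination-insert : ∀ {u s} → u ⊆ insert t s → f · combination col u ≡ u s ∧ f · col s
  ·-combination-insert {u} {s} u⊆t+s =
    trans (·-combination col f u) (⨁-single (λ i → u i ∧ f · col i) s vanish)
    where
    vanish : ∀ i → i ≢ s → u i ∧ f · col i ≡ false
    vanish i i≢s with u i in ui
    ... | false = refl
    ... | true  = f⊥t i (trans (sym (∨-identityʳ (t i)))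
                    (subst (λ b → t i ∨ b ≡ true) (≢⇒eqᵇ-false i≢s) (u⊆t+s i ui)))

  relation⇒annihilated : Independent col t → ∀ {u s} → u ⊆ insert t s → 0 < count u →
    (∀ r → combination col u r ≡ false) → f · col s ≡ false
  relation⇒annihilated indep {u} {s} u⊆t+s pos relation with u s in us
  ... | false = let r , ur = indep u (⊆-insert⁻ u⊆t+s us) pos
                in ⊥-elim (true≢false (trans (sym ur) (relation r)))
  ... | true  = begin
    f · col s              ≡⟨ cong (_∧ f · col s) (sym us) ⟩
    u s ∧ f · col s        ≡⟨ sym (·-combination-insert u⊆t+s) ⟩
    f · combination col u  ≡⟨ ⨁-none _ (λ r → trans (cong (f r ∧_) (relation r)) (∧-zeroʳ (f r))) ⟩
    false                  ∎
    where open ≡-Reasoning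

  insert-independent : Independent col t → ∀ {s} → f · col s ≡ true → Independent col (insert t s)
  insert-independent indep {s} fs u u⊆t+s pos with u s in us
  ... | false = indep u (⊆-insert⁻ u⊆t+s us) pos
  ... | true  =
    let r , fr∧ur = ⨁-true⇒Nonzero _ (trans (·-combination-insert u⊆t+s) (trans (cong (_∧ f · col s) us) fs))
    in r , proj₂ (∧-split fr∧ur)

module _ {n m : ℕ} (col : Fin m → GF2Vec n) where

  columnsOf : (Fin m → Bool) → List (GF2Vec n)
  columnsOf t = map col (filterᵇ t (allFin m))

  length-columnsOf : ∀ t → length (columnsOf t) ≡ count t
  length-columnsOf t = trans (length-map col (filterᵇ t (allFin m))) (length-filterᵇ-tabulate t id)

  -- Every column of S depends on a maximal independent t ⊆ S, so it is annihilated with t.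
  annihilates-basis⇒annihilates : ∀ {f t} S → Independent col t → t ⊆ mem S → count t ≡ rank col S →
    Annihilates f col t → Annihilates f col (mem S)
  annihilates-basis⇒annihilates {f} {t} S indep t⊆S t≡rank f⊥t s Ss
    with t s in ts | independentᵇ col (toSubset (insert t s)) in t+s-independent?
  ... | true  | _     = f⊥t s ts
  ... | false | false =
    let u , u⊆T , pos , relation = independentᵇ-false col (toSubset (insert t s)) t+s-independent?
    in relation⇒annihilated col f⊥t indep (⊆-toSubset⁻ u⊆T) pos relation
  ... | false | true  = ⊥-elim (<-irrefl refl (begin-strict
    rank col S          ≡⟨ sym t≡rank ⟩
    count t             <⟨ ≤-reflexive (sym (count-insert t s ts)) ⟩
    count (insert t s)  ≤⟨ count≤rank col S t+s-indep t+s⊆S ⟩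
    rank col S          ∎))
    where
    open ≤-Reasoning
    t+s-indep : Independent col (insert t s)
    t+s-indep u u⊆t+s = independentᵇ-sound col (toSubset (insert t s)) t+s-independent? u (⊆-toSubset⁺ u⊆t+s)
    t+s⊆S : insert t s ⊆ mem S
    t+s⊆S i t+si with t i in ti
    ... | true  = t⊆S i ti
    ... | false with refl ← eqᵇ⇒≡ {i = i} {s} t+si = Ss

  rank<dim⇒annihilator : ∀ S → rank col S < n → Σ (GF2Vec n) λ f → Nonzero f × Annihilates f col (mem S)
  rank<dim⇒annihilator S rank<n with rank-attained col S
  ... | t , indep , t⊆S , t≡rank
    with nontrivial-solution (columnsOf t) (λ _ → true)
           (subst₂ _<_ (sym (trans (length-columnsOf t) t≡rank)) (sym (count-all n)) rank<n)
  ...   | f , _ , 0<|f| , f⊥columns =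
    f , count-pos⇒Nonzero f 0<|f| ,
    annihilates-basis⇒annihilates S indep t⊆S t≡rank
      (λ i ti → All.lookup f⊥columns (∈-map⁺ col (∈-filterᵇ⁺ t (∈-allFin i) ti)))

mem-full : ∀ {m} (i : Fin m) → mem (full m) i ≡ true
mem-full zero    = refl
mem-full (suc i) = mem-full i

IdentityColumns : ∀ {n m} → (Fin m → GF2Vec n) → Set
IdentityColumns {n} {m} col = ∀ r → Σ (Fin m) λ i → ∀ r′ → col i r′ ≡ eqᵇ r′ r

module _ {n m : ℕ} {col : Fin m → GF2Vec n} (ids : IdentityColumns col) where

  ·-identityColumn : ∀ {f} r → f · col (proj₁ (ids r)) ≡ f r
  ·-identityColumn {f} r = ·-unitʳ f (col (proj₁ (ids r))) r (proj₂ (ids r))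

  annihilator⇒rank<dim : ∀ {f} S → Nonzero f → Annihilates f col (mem S) → rank col S < n
  annihilator⇒rank<dim {f} S (r , fr) f⊥S with rank-attained col S
  ... | t , indep , t⊆S , t≡rank = begin-strict
    rank col S          ≡⟨ sym t≡rank ⟩
    count t             <⟨ ≤-reflexive (sym (count-insert t i (outside (t i) refl))) ⟩
    count (insert t i)  ≤⟨ independent⇒count≤dim col t+i-independent ⟩
    n                   ∎
    where
    open ≤-Reasoning
    i : Fin m
    i = proj₁ (ids r)
    f⊥t : Annihilates f col t
    f⊥t j tj = f⊥S j (t⊆S j tj)
    t+i-independent : Independent col (insert t i)
    t+i-independent = insert-independent col f⊥t indep (trans (·-identityColumn r) fr)
    outside : ∀ b → t i ≡ b → t i ≡ false
    outside false ti = ti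
    outside true  ti = ⊥-elim (true≢false (trans (sym (trans (·-identityColumn r) fr)) (f⊥t i ti)))

  rankM≡dim : rankM col ≡ n
  rankM≡dim = ≤-antisym (rank≤dim col (full m)) (≮⇒≥ rankM≮n)
    where
    rankM≮n : ¬ rankM col < n
    rankM≮n rankM<n =
      let f , (r , fr) , f⊥all = rank<dim⇒annihilator col (full m) rankM<n
      in true≢false (trans (sym (trans (·-identityColumn r) fr)) (f⊥all _ (mem-full (proj₁ (ids r)))))

  identityColumn∈S⇒0<rank : ∀ S r → mem S (proj₁ (ids r)) ≡ true → 1 ≤ rank col S
  identityColumn∈S⇒0<rank S r Sᵢ = begin
    1                  ≡⟨ cong suc (sym (count-none (∅ {m}) (λ _ → refl))) ⟩
    suc (count (∅ {m})) ≡⟨ sym (count-insert ∅ i refl) ⟩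
    count (insert ∅ i) ≤⟨ count≤rank col S (insert-independent col {f = eᵣ} (λ _ ()) (∅-independent col) eᵣ·i) i⊆S ⟩
    rank col S         ∎
    where
    open ≤-Reasoning
    i : Fin m
    i = proj₁ (ids r)
    eᵣ : GF2Vec n
    eᵣ r′ = eqᵇ r′ r
    eᵣ·i : eᵣ · col i ≡ true
    eᵣ·i = trans (·-identityColumn r) (eqᵇ-refl r)
    i⊆S : insert ∅ i ⊆ mem S
    i⊆S j j≡i = subst (λ k → mem S k ≡ true) (sym (eqᵇ⇒≡ j≡i)) Sᵢ

-- Vertical separations and κ

m+n∸o<n⇒m<o : ∀ m n o → m + n ∸ o < n → m < o
m+n∸o<n⇒m<o m n o m+n∸o<n = ≰⇒> λ o≤m → <-irrefl refl (begin-strict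
  n              ≤⟨ m≤n+m n (m ∸ o) ⟩
  (m ∸ o) + n    ≡⟨ sym (+-∸-comm n o≤m) ⟩
  m + n ∸ o      <⟨ m+n∸o<n ⟩
  n              ∎)
  where open ≤-Reasoning

m+n∸o<m : ∀ m n o → 0 < m → n < o → m + n ∸ o < m
m+n∸o<m m n o 0<m n<o =
  m<n+o⇒m∸n<o (m + n) o {{>-nonZero 0<m}} (subst (m + n <_) (+-comm m o) (+-monoʳ-< m n<o))

mem-complement : ∀ {m} (S : Subset m) i → mem (complement S) i ≡ not (mem S i)
mem-complement (b Vec.∷ S) zero    = refl
mem-complement (b Vec.∷ S) (suc i) = mem-complement S i

module _ {n m : ℕ} (col : Fin m → GF2Vec n) where

  verticalSep⇒ranks<rankM : ∀ k S → verticalSepᵇ col k S ≡ true →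
    rank col S < rankM col × rank col (complement S) < rankM col
  verticalSep⇒ranks<rankM k S sep with ∧-split sep
  ... | λ<k , rest with ∧-split rest
  ...   | k≤rS , k≤rC =
    m+n∸o<n⇒m<o rS rC (rankM col) (<-≤-trans λ<k′ (≤ᵇ-true⁻ k≤rC)) ,
    m+n∸o<n⇒m<o rC rS (rankM col)
      (subst (_< rS) (cong (_∸ rankM col) (+-comm rS rC)) (<-≤-trans λ<k′ (≤ᵇ-true⁻ k≤rS)))
    where
    rS rC : ℕ
    rS = rank col S
    rC = rank col (complement S)
    λ<k′ : connectivity col S < k
    λ<k′ = <ᵇ-true⁻ λ<k

  ranks<rankM⇒verticalSep : ∀ S → 0 < rank col S → 0 < rank col (complement S) →
    rank col S < rankM col → rank col (complement S) < rankM col →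
    verticalSepᵇ col (suc (connectivity col S)) S ≡ true
  ranks<rankM⇒verticalSep S 0<rS 0<rC rS<R rC<R =
    cong₂ _∧_ (<ᵇ-true {connectivity col S} ≤-refl)
      (cong₂ _∧_ (≤ᵇ-true (m+n∸o<m rS rC R 0<rS rC<R))
                 (≤ᵇ-true (subst (_< rC) (cong (_∸ R) (+-comm rC rS)) (m+n∸o<m rC rS R 0<rC rS<R))))
    where
    rS rC R : ℕ
    rS = rank col S
    rC = rank col (complement S)
    R = rankM col

  kappaSearch-result : ∀ k fuel →
    (Σ ℕ λ j → hasVerticalSepᵇ col j ≡ true × kappaSearch col k fuel ≡ j) ⊎ kappaSearch col k fuel ≡ rankM col
  kappaSearch-result k zero = inj₂ refl
  kappaSearch-result k (suc fuel) with hasVerticalSepᵇ col k in sep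
  ... | true  = inj₁ (k , sep , refl)
  ... | false = kappaSearch-result (suc k) fuel

  kappaSearch-minimal : ∀ k fuel {j} → k ≤ j → j < k + fuel → hasVerticalSepᵇ col j ≡ true →
    kappaSearch col k fuel ≤ j
  kappaSearch-minimal k zero k≤j j<k+0 sep =
    ⊥-elim (<-irrefl refl (≤-<-trans k≤j (subst (_ <_) (+-identityʳ k) j<k+0)))
  kappaSearch-minimal k (suc fuel) {j} k≤j j<k+1+fuel sep with hasVerticalSepᵇ col k in sepₖ
  ... | true  = k≤j
  ... | false = kappaSearch-minimal (suc k) fuel (≤∧≢⇒< k≤j k≢j) (subst (j <_) (+-suc k fuel) j<k+1+fuel) sep
    where
    k≢j : k ≢ j
    k≢j refl = true≢false (trans (sym sep) sepₖ)

CoveredByTwoHyperplanes : ∀ {n m} → (Fin m → GF2Vec n) → Set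
CoveredByTwoHyperplanes {n} {m} col =
  Σ (GF2Vec n) λ f → Σ (GF2Vec n) λ g → Nonzero f × Nonzero g × (∀ i → f · col i ∧ g · col i ≡ false)

module _ {n m : ℕ} {col : Fin m → GF2Vec n} (ids : IdentityColumns col) where

  annihilators⇒covered : ∀ {f g} S → Annihilates f col (mem S) → Annihilates g col (mem (complement S)) →
    ∀ i → f · col i ∧ g · col i ≡ false
  annihilators⇒covered {f} {g} S f⊥S g⊥C i with mem S i in Sᵢ
  ... | true  = cong (_∧ g · col i) (f⊥S i Sᵢ)
  ... | false = trans (cong (f · col i ∧_) (g⊥C i (trans (mem-complement S i) (cong not Sᵢ)))) (∧-zeroʳ _)

  separation⇒covered : ∀ j S → verticalSepᵇ col j S ≡ true → CoveredByTwoHyperplanes col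
  separation⇒covered j S S-sep =
    let rS<R , rC<R = verticalSep⇒ranks<rankM col j S S-sep
        f , f≢0 , f⊥S = rank<dim⇒annihilator col S (subst (rank col S <_) (rankM≡dim ids) rS<R)
        g , g≢0 , g⊥C = rank<dim⇒annihilator col (complement S)
                          (subst (rank col (complement S) <_) (rankM≡dim ids) rC<R)
    in f , g , f≢0 , g≢0 , annihilators⇒covered S f⊥S g⊥C

  kappa<dim⇒covered : kappa col < n → CoveredByTwoHyperplanes col
  kappa<dim⇒covered κ<n = search-result (kappaSearch-result col 0 (rankM col))
    where
    search-result : (Σ ℕ λ j → hasVerticalSepᵇ col j ≡ true × kappa col ≡ j) ⊎ kappa col ≡ rankM col →
      CoveredByTwoHyperplanes col
    search-result (inj₁ (j , sep , _)) = let S , S-sep = any⁻ (verticalSepᵇ col j) (allSubsets m) sep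
                                         in separation⇒covered j S S-sep
    search-result (inj₂ κ≡R) = ⊥-elim (<-irrefl (trans κ≡R (rankM≡dim ids)) κ<n)

  -- The columns annihilated by f form a side S of a separation; the others are annihilated by g.
  covered⇒separation : CoveredByTwoHyperplanes col →
    Σ (Subset m) λ S → verticalSepᵇ col (suc (connectivity col S)) S ≡ true × suc (connectivity col S) < n
  covered⇒separation (f , g , (r₀ , fr₀) , (r₁ , gr₁) , disjoint) = S , S-sep , k<n
    where
    S : Subset m
    S = toSubset (λ i → not (f · col i))
    memS : ∀ i → mem S i ≡ not (f · col i)
    memS = mem-toSubset (λ i → not (f · col i))
    memC : ∀ i → mem (complement S) i ≡ f · col i
    memC i = trans (mem-complement S i) (trans (cong not (memS i)) (not-involutive (f · col i)))
    f⊥S : Annihilates f col (mem S)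
    f⊥S i Sᵢ = trans (sym (not-involutive (f · col i))) (cong not (trans (sym (memS i)) Sᵢ))
    g⊥C : Annihilates g col (mem (complement S))
    g⊥C i Cᵢ = trans (sym (cong (_∧ g · col i) (trans (sym (memC i)) Cᵢ))) (disjoint i)
    i₀ i₁ : Fin m
    i₀ = proj₁ (ids r₀)
    i₁ = proj₁ (ids r₁)
    f·i₁≡false : f · col i₁ ≡ false
    f·i₁≡false = trans (sym (∧-identityʳ (f · col i₁)))
      (trans (cong (f · col i₁ ∧_) (sym (trans (·-identityColumn ids r₁) gr₁))) (disjoint i₁))
    rS<n : rank col S < n
    rS<n = annihilator⇒rank<dim ids S (r₀ , fr₀) f⊥S
    rC<n : rank col (complement S) < n
    rC<n = annihilator⇒rank<dim ids (complement S) (r₁ , gr₁) g⊥C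
    0<rS : 0 < rank col S
    0<rS = identityColumn∈S⇒0<rank ids S r₁ (trans (memS i₁) (cong not f·i₁≡false))
    0<rC : 0 < rank col (complement S)
    0<rC = identityColumn∈S⇒0<rank ids (complement S) r₀ (trans (memC i₀) (trans (·-identityColumn ids r₀) fr₀))
    S-sep : verticalSepᵇ col (suc (connectivity col S)) S ≡ true
    S-sep = ranks<rankM⇒verticalSep col S 0<rS 0<rC (subst (rank col S <_) (sym (rankM≡dim ids)) rS<n)
              (subst (rank col (complement S) <_) (sym (rankM≡dim ids)) rC<n)
    k<n : suc (connectivity col S) < n
    k<n = ≤-<-trans (subst (λ R → rank col S + rank col (complement S) ∸ R < rank col S) (sym (rankM≡dim ids))
                      (m+n∸o<m (rank col S) (rank col (complement S)) n 0<rS rC<n)) rS<n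

  separation⇒kappa< : ∀ k S → verticalSepᵇ col k S ≡ true → k < n → kappa col < n
  separation⇒kappa< k S S-sep k<n = begin-strict
    kappa col  ≤⟨ kappaSearch-minimal col 0 (rankM col) z≤n (subst (k <_) (sym (rankM≡dim ids)) k<n)
                    (any⁺ (verticalSepᵇ col k) (∈-allSubsets S) S-sep) ⟩
    k          <⟨ k<n ⟩
    n          ∎
    where open ≤-Reasoning

  covered⇒kappa<dim : CoveredByTwoHyperplanes col → kappa col < n
  covered⇒kappa<dim covered =
    let S , S-sep , k<n = covered⇒separation covered
    in separation⇒kappa< (suc (connectivity col S)) S S-sep k<n

-- The columns of (I A A+I)

infixl 7 _⋆_

_⋆_ : ∀ {n} → GF2Vec n → Mat n → GF2Vec n
(f ⋆ A) j = f · (λ r → A r j)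

pairSupport : ∀ {n} → Mat n → GF2Vec n → GF2Vec n
pairSupport A f j = f j ∨ (f ⋆ A) j

DisjointSupports : ∀ {n} → Mat n → Set
DisjointSupports {n} A =
  Σ (GF2Vec n) λ f → Σ (GF2Vec n) λ g → Nonzero f × Nonzero g × (∀ j → pairSupport A f j ∧ pairSupport A g j ≡ false)

·-shifted-column : ∀ {n} (f : GF2Vec n) (A : Mat n) j → f · (λ r → A r j xor eqᵇ r j) ≡ (f ⋆ A) j xor f j
·-shifted-column f A j = trans (·-xorʳ f (λ r → A r j) (λ r → eqᵇ r j)) (cong ((f ⋆ A) j xor_) (⨁-delta f j))

module _ {n : ℕ} (G : Graph n) where

  IAS-unit : ∀ j r → IAScols G (j ↑ˡ (n + n)) r ≡ eqᵇ r j
  IAS-unit j r rewrite splitAt-↑ˡ n j (n + n) = refl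

  IAS-adjacency : ∀ j r → IAScols G (n ↑ʳ (j ↑ˡ n)) r ≡ adj G r j
  IAS-adjacency j r rewrite splitAt-↑ʳ n (n + n) (j ↑ˡ n) | splitAt-↑ˡ n j n = refl

  IAS-shifted : ∀ j r → IAScols G (n ↑ʳ (n ↑ʳ j)) r ≡ adj G r j xor eqᵇ r j
  IAS-shifted j r rewrite splitAt-↑ʳ n (n + n) (n ↑ʳ j) | splitAt-↑ʳ n n j = refl

  IAS-identityColumns : IdentityColumns (IAScols G)
  IAS-identityColumns r = r ↑ˡ (n + n) , IAS-unit r

  ·-IAS-unit : ∀ f j → f · IAScols G (j ↑ˡ (n + n)) ≡ f j
  ·-IAS-unit f j = ·-unitʳ f _ j (IAS-unit j)

  ·-IAS-adjacency : ∀ f j → f · IAScols G (n ↑ʳ (j ↑ˡ n)) ≡ (f ⋆ adj G) j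
  ·-IAS-adjacency f j = ⨁-cong (λ r → cong (f r ∧_) (IAS-adjacency j r))

  ·-IAS-shifted : ∀ f j → f · IAScols G (n ↑ʳ (n ↑ʳ j)) ≡ (f ⋆ adj G) j xor f j
  ·-IAS-shifted f j =
    trans (⨁-cong (λ r → cong (f r ∧_) (IAS-shifted j r))) (·-shifted-column f (adj G) j)

  -- The three columns e_j, A_j, A_j + e_j of (I A A+I) at vertex j are all annihilated
  -- by f or by g exactly when the pair supports of f and g avoid j.
  private
    columns⇒vertex : ∀ a b c d → a ∧ c ≡ false → b ∧ d ≡ false → (b xor a) ∧ (d xor c) ≡ false →
      (a ∨ b) ∧ (c ∨ d) ≡ false
    columns⇒vertex true  b     true  d     () _  _
    columns⇒vertex true  true  false true  _  () _
    columns⇒vertex true  true  false false _  _  _  = refl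
    columns⇒vertex true  false false true  _  _  ()
    columns⇒vertex true  false false false _  _  _  = refl
    columns⇒vertex false true  true  true  _  () _
    columns⇒vertex false true  true  false _  _  ()
    columns⇒vertex false true  false true  _  () _
    columns⇒vertex false true  false false _  _  _  = refl
    columns⇒vertex false false c     d     _  _  _  = refl

    vertex⇒columns : ∀ a b c d → (a ∨ b) ∧ (c ∨ d) ≡ false →
      a ∧ c ≡ false × b ∧ d ≡ false × (b xor a) ∧ (d xor c) ≡ false
    vertex⇒columns true  true  false false _ = refl , refl , refl
    vertex⇒columns true  false false false _ = refl , refl , refl
    vertex⇒columns false true  false false _ = refl , refl , refl
    vertex⇒columns false false c     d     _ = refl , refl , refl
    vertex⇒columns true  b     true  d     ()
    vertex⇒columns true  b     false true  ()
    vertex⇒columns false true  true  d     ()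
    vertex⇒columns false true  false true  ()

  covered⇒disjointSupports : CoveredByTwoHyperplanes (IAScols G) → DisjointSupports (adj G)
  covered⇒disjointSupports (f , g , f≢0 , g≢0 , covered) = f , g , f≢0 , g≢0 , λ j →
    columns⇒vertex (f j) ((f ⋆ adj G) j) (g j) ((g ⋆ adj G) j)
      (trans (sym (cong₂ _∧_ (·-IAS-unit f j) (·-IAS-unit g j))) (covered (j ↑ˡ (n + n))))
      (trans (sym (cong₂ _∧_ (·-IAS-adjacency f j) (·-IAS-adjacency g j))) (covered (n ↑ʳ (j ↑ˡ n))))
      (trans (sym (cong₂ _∧_ (·-IAS-shifted f j) (·-IAS-shifted g j))) (covered (n ↑ʳ (n ↑ʳ j))))

  disjointSupports⇒covered : DisjointSupports (adj G) → CoveredByTwoHyperplanes (IAScols G)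
  disjointSupports⇒covered (f , g , f≢0 , g≢0 , disjoint) = f , g , f≢0 , g≢0 , covered
    where
    at : ∀ j → f j ∧ g j ≡ false × (f ⋆ adj G) j ∧ (g ⋆ adj G) j ≡ false ×
               ((f ⋆ adj G) j xor f j) ∧ ((g ⋆ adj G) j xor g j) ≡ false
    at j = vertex⇒columns (f j) ((f ⋆ adj G) j) (g j) ((g ⋆ adj G) j) (disjoint j)
    covered : ∀ c → f · IAScols G c ∧ g · IAScols G c ≡ false
    covered c with splitAt n c
    ... | inj₁ j = trans (cong₂ _∧_ (⨁-delta f j) (⨁-delta g j)) (proj₁ (at j))
    ... | inj₂ c′ with splitAt n c′
    ...   | inj₁ j = proj₁ (proj₂ (at j))
    ...   | inj₂ j = trans (cong₂ _∧_ (·-shifted-column f (adj G) j) (·-shifted-column g (adj G) j))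
                           (proj₂ (proj₂ (at j)))

-- Local complementation

Symmetric : ∀ {n} → Mat n → Set
Symmetric A = ∀ i j → A i j ≡ A j i

flip-symmetric : ∀ {n} {A : Mat n} (c : Fin n → Fin n → Bool) → Symmetric A → Symmetric c →
  Symmetric (λ i j → if c i j then not (A i j) else A i j)
flip-symmetric c A-sym c-sym i j = cong₂ (λ b x → if b then not x else x) (c-sym i j) (A-sym i j)

nbrᵇ-sym : ∀ {n} {A : Mat n} → Symmetric A → ∀ v j → nbrᵇ A v j ≡ nbrᵇ A j v
nbrᵇ-sym A-sym v j = cong₂ (λ b x → not b ∧ x) (eqᵇ-sym v j) (A-sym v j)

LocStep-symmetric : ∀ {n} {A B : Mat n} → Symmetric A → LocStep A B → Symmetric B
LocStep-symmetric A-sym (loop v A) =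
  flip-symmetric (λ i j → eqᵇ i v ∧ eqᵇ j v) A-sym (λ i j → ∧-comm (eqᵇ i v) (eqᵇ j v))
LocStep-symmetric A-sym (simple v A) =
  flip-symmetric (λ i j → not (eqᵇ i j) ∧ nbrᵇ A v i ∧ nbrᵇ A v j) A-sym
    (λ i j → cong₂ (λ b x → not b ∧ x) (eqᵇ-sym i j) (∧-comm (nbrᵇ A v i) (nbrᵇ A v j)))
LocStep-symmetric A-sym (nonSimple v A) =
  flip-symmetric (λ i j → nbrᵇ A v i ∧ nbrᵇ A v j) A-sym (λ i j → ∧-comm (nbrᵇ A v i) (nbrᵇ A v j))

Star-symmetric : ∀ {n} {A B : Mat n} → Symmetric A → Star LocStep A B → Symmetric B
Star-symmetric A-sym ε          = A-sym
Star-symmetric A-sym (step ◅ steps) = Star-symmetric (LocStep-symmetric A-sym step) steps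

pairSupport-cong : ∀ {n} (A : Mat n) {f g : GF2Vec n} → (∀ r → f r ≡ g r) →
  ∀ j → pairSupport A f j ≡ pairSupport A g j
pairSupport-cong A f≗g j = cong₂ _∨_ (f≗g j) (⨁-cong (λ r → cong (_∧ A r j) (f≗g r)))

pairSupport⇒Nonzero : ∀ {n} (A : Mat n) {f} j → pairSupport A f j ≡ true → Nonzero f
pairSupport⇒Nonzero A {f} j support with find f
... | inj₁ f≢0  = f≢0
... | inj₂ f≡0 = ⊥-elim (true≢false (trans (sym support)
                   (cong₂ _∨_ (f≡0 j) (⨁-none _ (λ r → cong (_∧ A r j) (f≡0 r))))))

DisjointSupports-transfer : ∀ {n} {A B : Mat n} (φ : GF2Vec n → GF2Vec n) →
  (∀ f j → pairSupport A (φ f) j ≡ pairSupport B f j) → DisjointSupports B → DisjointSupports A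
DisjointSupports-transfer {A = A} {B} φ same (f , g , (r₀ , fr₀) , (r₁ , gr₁) , disjoint) =
  φ f , φ g ,
  pairSupport⇒Nonzero A r₀ (trans (same f r₀) (cong (_∨ (f ⋆ B) r₀) fr₀)) ,
  pairSupport⇒Nonzero A r₁ (trans (same g r₁) (cong (_∨ (g ⋆ B) r₁) gr₁)) ,
  λ j → trans (cong₂ _∧_ (same f j) (same g j)) (disjoint j)

module _ {n : ℕ} (A : Mat n) (v : Fin n) where

  ⋆-loopComp : ∀ f j → (f ⋆ loopComp v A) j ≡ (f ⋆ A) j xor (eqᵇ j v ∧ f v)
  ⋆-loopComp f j = begin
    f · (λ r → loopComp v A r j)
      ≡⟨ ⨁-cong (λ r → cong (f r ∧_) (entry r)) ⟩
    f · (λ r → A r j xor (eqᵇ j v ∧ eqᵇ r v))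
      ≡⟨ ·-xorʳ f (λ r → A r j) (λ r → eqᵇ j v ∧ eqᵇ r v) ⟩
    (f ⋆ A) j xor f · (λ r → eqᵇ j v ∧ eqᵇ r v)
      ≡⟨ cong ((f ⋆ A) j xor_) (·-scaleʳ f (λ r → eqᵇ r v) (eqᵇ j v)) ⟩
    (f ⋆ A) j xor (eqᵇ j v ∧ f · (λ r → eqᵇ r v))
      ≡⟨ cong (λ b → (f ⋆ A) j xor (eqᵇ j v ∧ b)) (⨁-delta f v) ⟩
    (f ⋆ A) j xor (eqᵇ j v ∧ f v)
      ∎
    where
    open ≡-Reasoning
    entry : ∀ r → loopComp v A r j ≡ A r j xor (eqᵇ j v ∧ eqᵇ r v)
    entry r = trans (if-not≡xor (eqᵇ r v ∧ eqᵇ j v) (A r j)) (cong (A r j xor_) (∧-comm (eqᵇ r v) (eqᵇ j v)))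

  pairSupport-loopComp : ∀ f j → pairSupport A f j ≡ pairSupport (loopComp v A) f j
  pairSupport-loopComp f j = sym (trans (cong (f j ∨_) (⋆-loopComp f j)) (unchanged (eqᵇ j v) refl))
    where
    unchanged : ∀ b → eqᵇ j v ≡ b → f j ∨ ((f ⋆ A) j xor (b ∧ f v)) ≡ f j ∨ (f ⋆ A) j
    unchanged false _   = cong (f j ∨_) (xor-identityʳ _)
    unchanged true  j≟v with refl ← eqᵇ⇒≡ j≟v = absorb (f j) ((f ⋆ A) j)
      where
      absorb : ∀ x y → x ∨ (y xor (true ∧ x)) ≡ x ∨ y
      absorb true  y = refl
      absorb false y = cong (false ∨_) (xor-identityʳ y)

twist : ∀ {n} → Mat n → Fin n → GF2Vec n → GF2Vec n
twist A v f j = f j xor (eqᵇ j v ∧ f · nbrᵇ A v)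

module _ {n : ℕ} {A : Mat n} (A-sym : Symmetric A) (v : Fin n) where

  private
    N : GF2Vec n
    N = nbrᵇ A v

  nbrᵇ-self : N v ≡ false
  nbrᵇ-self = cong (λ b → not b ∧ A v v) (eqᵇ-refl v)

  nbrᵇ-other : ∀ {j} → eqᵇ j v ≡ false → N j ≡ A v j
  nbrᵇ-other {j} j≢v = cong (λ b → not b ∧ A v j) (trans (eqᵇ-sym v j) j≢v)

  ⋆-twist : ∀ f j → (twist A v f ⋆ A) j ≡ (f ⋆ A) j xor (f · N ∧ A v j)
  ⋆-twist f j = trans (·-xorˡ f (λ r → eqᵇ r v ∧ f · N) (λ r → A r j))
                      (cong ((f ⋆ A) j xor_) (·-unitˡ (λ r → A r j) v (f · N)))

  ⋆-centre : ∀ f → (f ⋆ A) v ≡ f · N xor (A v v ∧ f v)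
  ⋆-centre f = begin
    f · (λ r → A r v)                           ≡⟨ ⨁-cong (λ r → cong (f r ∧_) (entry r)) ⟩
    f · (λ r → N r xor (eqᵇ r v ∧ A v v))       ≡⟨ ·-xorʳ f N (λ r → eqᵇ r v ∧ A v v) ⟩
    f · N xor f · (λ r → eqᵇ r v ∧ A v v)       ≡⟨ cong (f · N xor_) (trans (·-comm f _) (·-unitˡ f v (A v v))) ⟩
    f · N xor (A v v ∧ f v)                     ∎
    where
    open ≡-Reasoning
    entry : ∀ r → A r v ≡ N r xor (eqᵇ r v ∧ A v v)
    entry r with eqᵇ r v in r≟v
    ... | false = trans (A-sym r v) (trans (sym (nbrᵇ-other r≟v)) (sym (xor-identityʳ (N r))))
    ... | true with refl ← eqᵇ⇒≡ r≟v = cong (_xor A r r) (sym nbrᵇ-self)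

  module _ (A′ : Mat n) (d : GF2Vec n)
           (A′-entry : ∀ r j → A′ r j ≡ A r j xor ((N j ∧ N r) xor (d j ∧ eqᵇ r j))) where

    ⋆-complement : ∀ f j → (f ⋆ A′) j ≡ (f ⋆ A) j xor ((N j ∧ f · N) xor (f j ∧ d j))
    ⋆-complement f j = begin
      f · (λ r → A′ r j)
        ≡⟨ ⨁-cong (λ r → cong (f r ∧_) (A′-entry r j)) ⟩
      f · (λ r → A r j xor ((N j ∧ N r) xor (d j ∧ eqᵇ r j)))
        ≡⟨ ·-xorʳ f (λ r → A r j) _ ⟩
      (f ⋆ A) j xor f · (λ r → (N j ∧ N r) xor (d j ∧ eqᵇ r j))
        ≡⟨ cong ((f ⋆ A) j xor_) (·-xorʳ f (λ r → N j ∧ N r) (λ r → d j ∧ eqᵇ r j)) ⟩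
      (f ⋆ A) j xor (f · (λ r → N j ∧ N r) xor f · (λ r → d j ∧ eqᵇ r j))
        ≡⟨ cong ((f ⋆ A) j xor_) (cong₂ _xor_ (·-scaleʳ f N (N j)) (·-scaleʳ f (λ r → eqᵇ r j) (d j))) ⟩
      (f ⋆ A) j xor ((N j ∧ f · N) xor (d j ∧ f · (λ r → eqᵇ r j)))
        ≡⟨ cong (λ b → (f ⋆ A) j xor ((N j ∧ f · N) xor b)) (trans (cong (d j ∧_) (⨁-delta f j)) (∧-comm (d j) (f j))) ⟩
      (f ⋆ A) j xor ((N j ∧ f · N) xor (f j ∧ d j))
        ∎
      where open ≡-Reasoning

    pairSupport-complement : ∀ f j → pairSupport A (twist A v f) j ≡ pairSupport A′ f j
    pairSupport-complement f j with eqᵇ j v in j≟v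
    ... | false = begin
      (f j xor false) ∨ (twist A v f ⋆ A) j                ≡⟨ cong₂ _∨_ (xor-identityʳ (f j)) (⋆-twist f j) ⟩
      f j ∨ ((f ⋆ A) j xor (s ∧ A v j))                    ≡⟨ cong (λ b → f j ∨ ((f ⋆ A) j xor b))
                                                              (trans (∧-comm s (A v j)) (cong (_∧ s) (sym (nbrᵇ-other j≟v)))) ⟩
      f j ∨ ((f ⋆ A) j xor (N j ∧ s))                      ≡⟨ loop-irrelevant (f j) ((f ⋆ A) j) (N j ∧ s) (d j) ⟩
      f j ∨ ((f ⋆ A) j xor ((N j ∧ s) xor (f j ∧ d j)))    ≡⟨ cong (f j ∨_) (sym (⋆-complement f j)) ⟩
      f j ∨ (f ⋆ A′) j                                    ∎
      where
      open ≡-Reasoning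
      s : Bool
      s = f · N
      loop-irrelevant : ∀ x y z w → x ∨ (y xor z) ≡ x ∨ (y xor (z xor (x ∧ w)))
      loop-irrelevant true  y z w = refl
      loop-irrelevant false y z w = cong (λ b → y xor b) (sym (xor-identityʳ z))
    ... | true with refl ← eqᵇ⇒≡ j≟v = begin
      (f v xor (true ∧ s)) ∨ (twist A v f ⋆ A) v
        ≡⟨ cong ((f v xor s) ∨_) (trans (⋆-twist f v) (cong (_xor (s ∧ A v v)) (⋆-centre f))) ⟩
      (f v xor s) ∨ ((s xor (A v v ∧ f v)) xor (s ∧ A v v))
        ≡⟨ centre (f v) s (A v v) (d v) ⟩
      f v ∨ ((s xor (A v v ∧ f v)) xor ((false ∧ s) xor (f v ∧ d v)))
        ≡⟨ cong (λ b → f v ∨ (b xor ((false ∧ s) xor (f v ∧ d v)))) (sym (⋆-centre f)) ⟩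
      f v ∨ ((f ⋆ A) v xor ((false ∧ s) xor (f v ∧ d v)))
        ≡⟨ cong (λ b → f v ∨ ((f ⋆ A) v xor ((b ∧ s) xor (f v ∧ d v)))) (sym nbrᵇ-self) ⟩
      f v ∨ ((f ⋆ A) v xor ((N v ∧ s) xor (f v ∧ d v)))
        ≡⟨ cong (f v ∨_) (sym (⋆-complement f v)) ⟩
      f v ∨ (f ⋆ A′) v
        ∎
      where
      open ≡-Reasoning
      s : Bool
      s = f · N
      centre : ∀ x s c w → (x xor s) ∨ ((s xor (c ∧ x)) xor (s ∧ c))
                         ≡ x ∨ ((s xor (c ∧ x)) xor ((false ∧ s) xor (x ∧ w)))
      centre true  true  true  w = refl
      centre true  true  false w = refl
      centre true  false c     w = refl
      centre false true  true  w = refl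
      centre false true  false w = refl
      centre false false true  w = refl
      centre false false false w = refl

nonSimpleLocComp-entry : ∀ {n} (A : Mat n) v r j →
  nonSimpleLocComp v A r j ≡ A r j xor ((nbrᵇ A v j ∧ nbrᵇ A v r) xor (false ∧ eqᵇ r j))
nonSimpleLocComp-entry A v r j =
  trans (if-not≡xor (nbrᵇ A v r ∧ nbrᵇ A v j) (A r j))
        (cong (A r j xor_) (trans (∧-comm (nbrᵇ A v r) (nbrᵇ A v j)) (sym (xor-identityʳ (nbrᵇ A v j ∧ nbrᵇ A v r)))))

simpleLocComp-entry : ∀ {n} (A : Mat n) v r j →
  simpleLocComp v A r j ≡ A r j xor ((nbrᵇ A v j ∧ nbrᵇ A v r) xor (nbrᵇ A v j ∧ eqᵇ r j))
simpleLocComp-entry A v r j =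
  trans (if-not≡xor (not (eqᵇ r j) ∧ nbrᵇ A v r ∧ nbrᵇ A v j) (A r j)) (cong (A r j xor_) condition)
  where
  condition : not (eqᵇ r j) ∧ nbrᵇ A v r ∧ nbrᵇ A v j ≡ (nbrᵇ A v j ∧ nbrᵇ A v r) xor (nbrᵇ A v j ∧ eqᵇ r j)
  condition with eqᵇ r j in r≟j
  ... | false = trans (∧-comm (nbrᵇ A v r) (nbrᵇ A v j))
                      (sym (trans (cong ((nbrᵇ A v j ∧ nbrᵇ A v r) xor_) (∧-zeroʳ (nbrᵇ A v j)))
                                  (xor-identityʳ (nbrᵇ A v j ∧ nbrᵇ A v r))))
  ... | true with refl ← eqᵇ⇒≡ r≟j = cancel (nbrᵇ A v r)
    where
    cancel : ∀ b → false ≡ (b ∧ b) xor (b ∧ true)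
    cancel true  = refl
    cancel false = refl

twist-involutive : ∀ {n} (A : Mat n) v f j → twist A v (twist A v f) j ≡ f j
twist-involutive {n} A v f j = begin
  (f j xor (eqᵇ j v ∧ s)) xor (eqᵇ j v ∧ twist A v f · N)
    ≡⟨ cong (λ b → (f j xor (eqᵇ j v ∧ s)) xor (eqᵇ j v ∧ b)) twist·N ⟩
  (f j xor (eqᵇ j v ∧ s)) xor (eqᵇ j v ∧ s)
    ≡⟨ xor-assoc (f j) (eqᵇ j v ∧ s) (eqᵇ j v ∧ s) ⟩
  f j xor ((eqᵇ j v ∧ s) xor (eqᵇ j v ∧ s))
    ≡⟨ cong (f j xor_) (xor-same (eqᵇ j v ∧ s)) ⟩
  f j xor false
    ≡⟨ xor-identityʳ (f j) ⟩
  f j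
    ∎
  where
  open ≡-Reasoning
  N : GF2Vec n
  N = nbrᵇ A v
  s : Bool
  s = f · N
  twist·N : twist A v f · N ≡ s
  twist·N = begin
    twist A v f · N      ≡⟨ ·-xorˡ f (λ r → eqᵇ r v ∧ s) N ⟩
    s xor (λ r → eqᵇ r v ∧ s) · N ≡⟨ cong (s xor_) (·-unitˡ N v s) ⟩
    s xor (s ∧ N v)      ≡⟨ cong (λ b → s xor (s ∧ b)) (cong (λ b → not b ∧ A v v) (eqᵇ-refl v)) ⟩
    s xor (s ∧ false)    ≡⟨ cong (s xor_) (∧-zeroʳ s) ⟩
    s xor false          ≡⟨ xor-identityʳ s ⟩
    s                    ∎

pairSupport-nonSimple-twist : ∀ {n} {A : Mat n} → Symmetric A → ∀ v f j →
  pairSupport (nonSimpleLocComp v A) (twist A v f) j ≡ pairSupport A f j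
pairSupport-nonSimple-twist {A = A} A-sym v f j =
  trans (sym (pairSupport-complement A-sym v (nonSimpleLocComp v A) (λ _ → false) (nonSimpleLocComp-entry A v) (twist A v f) j))
        (pairSupport-cong A (twist-involutive A v f) j)

LocStep-reflects-disjoint : ∀ {n} {A B : Mat n} → Symmetric A → LocStep A B → DisjointSupports B → DisjointSupports A
LocStep-reflects-disjoint A-sym (loop v A) =
  DisjointSupports-transfer id (pairSupport-loopComp A v)
LocStep-reflects-disjoint A-sym (simple v A) =
  DisjointSupports-transfer (twist A v)
    (pairSupport-complement A-sym v (simpleLocComp v A) (nbrᵇ A v) (simpleLocComp-entry A v))
LocStep-reflects-disjoint A-sym (nonSimple v A) =
  DisjointSupports-transfer (twist A v)
    (pairSupport-complement A-sym v (nonSimpleLocComp v A) (λ _ → false) (nonSimpleLocComp-entry A v))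

Star-reflects-disjoint : ∀ {n} {A B : Mat n} → Symmetric A → Star LocStep A B → DisjointSupports B → DisjointSupports A
Star-reflects-disjoint A-sym ε              = id
Star-reflects-disjoint A-sym (step ◅ steps) =
  LocStep-reflects-disjoint A-sym step ∘ Star-reflects-disjoint (LocStep-symmetric A-sym step) steps

-- Low degree and disjoint supports

closedNbhd : ∀ {n} → Mat n → Fin n → GF2Vec n
closedNbhd A v j = eqᵇ j v ∨ nbrᵇ A v j

count-closedNbhd : ∀ {n} (A : Mat n) v → count (closedNbhd A v) ≡ suc (count (nbrᵇ A v))
count-closedNbhd A v =
  trans (count-remove (closedNbhd A v) v (cong (_∨ nbrᵇ A v v) (eqᵇ-refl v))) (cong suc (count-cong removed))
  where
  removed : ∀ j → remove (closedNbhd A v) v j ≡ nbrᵇ A v j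
  removed j with eqᵇ j v in j≟v
  ... | false = ∧-identityʳ (nbrᵇ A v j)
  ... | true with refl ← eqᵇ⇒≡ j≟v = sym (cong (λ b → not b ∧ A j j) (eqᵇ-refl j))

unitVec : ∀ {n} → Fin n → GF2Vec n
unitVec v j = eqᵇ j v

pairSupport-unit : ∀ {n} (A : Mat n) v j → pairSupport A (unitVec v) j ≡ closedNbhd A v j
pairSupport-unit A v j with eqᵇ j v in j≟v
... | true  = refl
... | false = trans (trans (·-comm (unitVec v) (λ r → A r j)) (⨁-delta (λ r → A r j) v))
                    (sym (cong (λ b → not b ∧ A v j) (trans (eqᵇ-sym v j) j≟v)))

2*d<n∸1⇒1+d+d<n : ∀ d n → 2 * d < n ∸ 1 → suc d + d < n
2*d<n∸1⇒1+d+d<n d (suc n) 2d<n = s≤s (subst (_< n) (cong (d +_) (+-identityʳ d)) 2d<n)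

module _ {n : ℕ} {A : Mat n} (A-sym : Symmetric A) (v : Fin n) where

  private
    N M : GF2Vec n
    N = nbrᵇ A v
    M = closedNbhd A v

    unit-rows column-rows : List (GF2Vec n)
    unit-rows = map (λ j r → eqᵇ r j) (filterᵇ M (allFin n))
    column-rows = map (λ j r → A r j) (filterᵇ N (allFin n))

    length-rows : length (unit-rows ++ column-rows) ≡ suc (count N) + count N
    length-rows = begin
      length (unit-rows ++ column-rows)                               ≡⟨ length-++ unit-rows ⟩
      length unit-rows + length column-rows                           ≡⟨ cong₂ _+_ (length-map _ (filterᵇ M (allFin n)))
                                                                                    (length-map _ (filterᵇ N (allFin n))) ⟩
      length (filterᵇ M (allFin n)) + length (filterᵇ N (allFin n))   ≡⟨ cong₂ _+_ (length-filterᵇ-tabulate M id)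
                                                                                    (length-filterᵇ-tabulate N id) ⟩
      count M + count N                                               ≡⟨ cong (_+ count N) (count-closedNbhd A v) ⟩
      suc (count N) + count N                                         ∎
      where open ≡-Reasoning

  -- g = 0 on N[v] and g ⋆ A = 0 on N(v) are 2 deg v + 1 < n homogeneous linear conditions on g.
  closedNbhd-avoider : suc (count (nbrᵇ A v)) + count (nbrᵇ A v) < n →
    Σ (GF2Vec n) λ g → Nonzero g × (∀ j → closedNbhd A v j ≡ true → pairSupport A g j ≡ false)
  closedNbhd-avoider few-conditions
    with nontrivial-solution (unit-rows ++ column-rows) (λ _ → true)
           (subst₂ _<_ (sym length-rows) (sym (count-all n)) few-conditions)
  ... | g , _ , 0<|g| , solves = g , count-pos⇒Nonzero g 0<|g| , λ j Mj → cong₂ _∨_ (g-off-M j Mj) (g⋆A-off-M j Mj)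
    where
    g-off-M : ∀ j → M j ≡ true → g j ≡ false
    g-off-M j Mj = trans (sym (⨁-delta g j))
      (All.lookup solves (∈-++⁺ˡ (∈-map⁺ (λ j r → eqᵇ r j) (∈-filterᵇ⁺ M (∈-allFin j) Mj))))
    g⋆A-off-N : ∀ j → N j ≡ true → (g ⋆ A) j ≡ false
    g⋆A-off-N j Nj =
      All.lookup solves (∈-++⁺ʳ unit-rows (∈-map⁺ (λ j r → A r j) (∈-filterᵇ⁺ N (∈-allFin j) Nj)))
    g·N≡false : g · N ≡ false
    g·N≡false = ⨁-none (λ r → g r ∧ N r) vanish
      where
      vanish : ∀ r → g r ∧ N r ≡ false
      vanish r with N r in Nr
      ... | false = ∧-zeroʳ (g r)
      ... | true  = cong (_∧ true) (g-off-M r (trans (cong (eqᵇ r v ∨_) Nr) (∨-zeroʳ _)))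
    g⋆A-off-M : ∀ j → M j ≡ true → (g ⋆ A) j ≡ false
    g⋆A-off-M j Mj with eqᵇ j v in j≟v
    ... | false = g⋆A-off-N j Mj
    ... | true with refl ← eqᵇ⇒≡ j≟v = begin
      (g ⋆ A) v                 ≡⟨ ⋆-centre A-sym v g ⟩
      g · N xor (A v v ∧ g v)   ≡⟨ cong₂ (λ a b → a xor (A v v ∧ b)) g·N≡false gv≡false ⟩
      false xor (A v v ∧ false) ≡⟨ ∧-zeroʳ (A v v) ⟩
      false                     ∎
      where
      open ≡-Reasoning
      gv≡false : g v ≡ false
      gv≡false = g-off-M v (cong (_∨ N v) (eqᵇ-refl v))

  lowDegree⇒disjointSupports : 2 * count (nbrᵇ A v) < n ∸ 1 → DisjointSupports A
  lowDegree⇒disjointSupports low with closedNbhd-avoider (2*d<n∸1⇒1+d+d<n (count N) n low)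
  ... | g , g≢0 , g-avoids = unitVec v , g , (v , eqᵇ-refl v) , g≢0 , disjoint
    where
    disjoint : ∀ j → pairSupport A (unitVec v) j ∧ pairSupport A g j ≡ false
    disjoint j with M j in Mj
    ... | false = cong (_∧ pairSupport A g j) (trans (pairSupport-unit A v j) Mj)
    ... | true  = trans (cong₂ _∧_ (pairSupport-unit A v j) (g-avoids j Mj)) (∧-zeroʳ _)

-- Shrinking a support by local complementation

count-twist : ∀ {n} (A : Mat n) x f → f x ≡ true → f · nbrᵇ A x ≡ true → count f ≡ suc (count (twist A x f))
count-twist A x f fx sx = trans (count-remove f x fx) (cong suc (count-cong removed))
  where
  removed : ∀ j → remove f x j ≡ twist A x f j
  removed j with eqᵇ j x in j≟x
  ... | false = trans (∧-identityʳ (f j)) (sym (xor-identityʳ (f j)))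
  ... | true with refl ← eqᵇ⇒≡ j≟x rewrite fx | sx = refl

twist-quiet : ∀ {n} (A : Mat n) u f → f · nbrᵇ A u ≡ false → ∀ j → twist A u f j ≡ f j
twist-quiet A u f quiet j = trans (cong (λ b → f j xor (eqᵇ j u ∧ b)) quiet)
                                  (trans (cong (f j xor_) (∧-zeroʳ (eqᵇ j u))) (xor-identityʳ (f j)))

·-nbrᵇ-nonSimple : ∀ {n} (A : Mat n) u x f → nbrᵇ A u x ≡ true →
  f · nbrᵇ (nonSimpleLocComp u A) x ≡ f · nbrᵇ A x xor (f · nbrᵇ A u xor (f x ∧ nbrᵇ A u x))
·-nbrᵇ-nonSimple A u x f ux = begin
  f · nbrᵇ (nonSimpleLocComp u A) x
    ≡⟨ ⨁-cong (λ r → cong (f r ∧_) (entry r)) ⟩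
  f · (λ r → nbrᵇ A x r xor (nbrᵇ A u r xor (eqᵇ r x ∧ nbrᵇ A u r)))
    ≡⟨ ·-xorʳ f (nbrᵇ A x) _ ⟩
  f · nbrᵇ A x xor f · (λ r → nbrᵇ A u r xor (eqᵇ r x ∧ nbrᵇ A u r))
    ≡⟨ cong (f · nbrᵇ A x xor_) (·-xorʳ f (nbrᵇ A u) _) ⟩
  f · nbrᵇ A x xor (f · nbrᵇ A u xor f · (λ r → eqᵇ r x ∧ nbrᵇ A u r))
    ≡⟨ cong (λ b → f · nbrᵇ A x xor (f · nbrᵇ A u xor b))
         (trans (⨁-cong (λ r → swap (f r) (eqᵇ r x) (nbrᵇ A u r))) (⨁-delta (λ r → f r ∧ nbrᵇ A u r) x)) ⟩
  f · nbrᵇ A x xor (f · nbrᵇ A u xor (f x ∧ nbrᵇ A u x))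
    ∎
  where
  open ≡-Reasoning
  swap : ∀ a b c → a ∧ (b ∧ c) ≡ (a ∧ c) ∧ b
  swap = solve 3 (λ a b c → a :* (b :* c) := (a :* c) :* b) refl
  entry : ∀ r → nbrᵇ (nonSimpleLocComp u A) x r ≡ nbrᵇ A x r xor (nbrᵇ A u r xor (eqᵇ r x ∧ nbrᵇ A u r))
  entry r with eqᵇ r x in r≟x
  ... | true with refl ← eqᵇ⇒≡ r≟x =
    trans (cong (λ b → not b ∧ nonSimpleLocComp u A r r) (eqᵇ-refl r))
          (sym (cong₂ _xor_ (cong (λ b → not b ∧ A r r) (eqᵇ-refl r)) (xor-same (nbrᵇ A u r))))
  ... | false = begin
    not (eqᵇ x r) ∧ nonSimpleLocComp u A x r
      ≡⟨ cong (λ b → not b ∧ nonSimpleLocComp u A x r) x≢r ⟩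
    nonSimpleLocComp u A x r
      ≡⟨ if-not≡xor (nbrᵇ A u x ∧ nbrᵇ A u r) (A x r) ⟩
    A x r xor (nbrᵇ A u x ∧ nbrᵇ A u r)
      ≡⟨ cong₂ (λ a b → a xor (b ∧ nbrᵇ A u r)) (cong (λ b → not b ∧ A x r) (sym x≢r)) ux ⟩
    nbrᵇ A x r xor nbrᵇ A u r
      ≡⟨ cong (nbrᵇ A x r xor_) (sym (xor-identityʳ (nbrᵇ A u r))) ⟩
    nbrᵇ A x r xor (nbrᵇ A u r xor false)
      ∎
    where
    x≢r : eqᵇ x r ≡ false
    x≢r = trans (eqᵇ-sym x r) r≟x

NeighbourhoodInside : ∀ {n} → Mat n → GF2Vec n → Set
NeighbourhoodInside {n} A f =
  Σ (Mat n) λ B → Star LocStep A B × Σ (Fin n) λ v → closedNbhd B v ⊆ pairSupport A f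

NeighbourhoodInside-transfer : ∀ {n} {A A′ : Mat n} {f f′} → LocStep A A′ →
  (∀ j → pairSupport A′ f′ j ≡ pairSupport A f j) → NeighbourhoodInside A′ f′ → NeighbourhoodInside A f
NeighbourhoodInside-transfer step same (B , A′~B , v , inside) =
  B , step ◅ A′~B , v , λ j Nj → trans (sym (same j)) (inside j Nj)

NeighbourhoodInsideBelow : ℕ → ℕ → Set
NeighbourhoodInsideBelow n k =
  ∀ {A : Mat n} → Symmetric A → ∀ f → Nonzero f → count f ≤ k → NeighbourhoodInside A f

-- Complementing at x with f x = f · N(x) = 1 removes x from the twisted f.
pivot-step : ∀ {n k} → NeighbourhoodInsideBelow n k → ∀ {A : Mat n} → Symmetric A → ∀ f x →
  f x ≡ true → f · nbrᵇ A x ≡ true → count f ≤ suc k → NeighbourhoodInside A f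
pivot-step {k = k} below {A} A-sym f x fx sx |f|≤1+k =
  NeighbourhoodInside-transfer (nonSimple x A) (pairSupport-nonSimple-twist A-sym x f)
    (below (LocStep-symmetric A-sym (nonSimple x A)) (twist A x f) twisted≢0
           (≤-pred (subst (_≤ suc k) (count-twist A x f fx sx) |f|≤1+k)))
  where
  twisted≢0 : Nonzero (twist A x f)
  twisted≢0 = pairSupport⇒Nonzero (nonSimpleLocComp x A) x
                (trans (pairSupport-nonSimple-twist A-sym x f x) (cong (_∨ (f ⋆ A) x) fx))

-- Complementing at a neighbour j of r outside the support leaves the support of f unchanged
-- (f · N(j) = 0) and makes r a pivot.
outside-step : ∀ {n k} → NeighbourhoodInsideBelow n k → ∀ {A : Mat n} → Symmetric A → ∀ f r j →
  f r ≡ true → f · nbrᵇ A r ≡ false → nbrᵇ A r j ≡ true → pairSupport A f j ≡ false → count f ≤ suc k →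
  NeighbourhoodInside A f
outside-step below {A} A-sym f r j fr quiet-r rj outside |f|≤1+k =
  NeighbourhoodInside-transfer (nonSimple j A) support-unchanged
    (pivot-step below (LocStep-symmetric A-sym (nonSimple j A)) f r fr pivot |f|≤1+k)
  where
  fj≡false : f j ≡ false
  fj≡false = proj₁ (∨-false outside)
  quiet-j : f · nbrᵇ A j ≡ false
  quiet-j = begin
    f · nbrᵇ A j                        ≡⟨ sym (xor-identityʳ (f · nbrᵇ A j)) ⟩
    f · nbrᵇ A j xor false              ≡⟨ cong (f · nbrᵇ A j xor_) (sym loop-term) ⟩
    f · nbrᵇ A j xor (A j j ∧ f j)      ≡⟨ sym (⋆-centre A-sym j f) ⟩
    (f ⋆ A) j                           ≡⟨ proj₂ (∨-false outside) ⟩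
    false                               ∎
    where
    open ≡-Reasoning
    loop-term : A j j ∧ f j ≡ false
    loop-term = trans (cong (A j j ∧_) fj≡false) (∧-zeroʳ (A j j))
  support-unchanged : ∀ i → pairSupport (nonSimpleLocComp j A) f i ≡ pairSupport A f i
  support-unchanged i = trans (pairSupport-cong (nonSimpleLocComp j A) (λ r → sym (twist-quiet A j f quiet-j r)) i)
                              (pairSupport-nonSimple-twist A-sym j f i)
  pivot : f · nbrᵇ (nonSimpleLocComp j A) r ≡ true
  pivot = begin
    f · nbrᵇ (nonSimpleLocComp j A) r
      ≡⟨ ·-nbrᵇ-nonSimple A j r f jr ⟩
    f · nbrᵇ A r xor (f · nbrᵇ A j xor (f r ∧ nbrᵇ A j r))
      ≡⟨ cong₂ (λ a b → a xor (b xor (f r ∧ nbrᵇ A j r))) quiet-r quiet-j ⟩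
    f r ∧ nbrᵇ A j r
      ≡⟨ cong₂ _∧_ fr jr ⟩
    true
      ∎
    where
    open ≡-Reasoning
    jr : nbrᵇ A j r ≡ true
    jr = trans (nbrᵇ-sym A-sym j r) rj

neighbourhood-inside-support : ∀ {n k} → NeighbourhoodInsideBelow n k
neighbourhood-inside-support {k = zero} A-sym f f≢0 |f|≤0 =
  ⊥-elim (<-irrefl refl (≤-trans (Nonzero⇒count-pos f f≢0) |f|≤0))
neighbourhood-inside-support {k = suc k} {A} A-sym f (r , fr) |f|≤1+k
  with find (λ x → f x ∧ f · nbrᵇ A x)
... | inj₁ (x , pivot) =
  pivot-step neighbourhood-inside-support A-sym f x (proj₁ (∧-split pivot)) (proj₂ (∧-split pivot)) |f|≤1+k
... | inj₂ no-pivot with find (λ j → nbrᵇ A r j ∧ not (pairSupport A f j))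
...   | inj₁ (j , outside) =
  outside-step neighbourhood-inside-support A-sym f r j fr (trans (sym (cong (_∧ f · nbrᵇ A r) fr)) (no-pivot r))
    (proj₁ (∧-split outside)) (not-true (proj₂ (∧-split outside))) |f|≤1+k
  where
  not-true : ∀ {b} → not b ≡ true → b ≡ false
  not-true {false} _ = refl
...   | inj₂ inside = A , ε , r , closedNbhd⊆support
  where
  closedNbhd⊆support : closedNbhd A r ⊆ pairSupport A f
  closedNbhd⊆support i i∈N[r] with eqᵇ i r in i≟r
  ... | true with refl ← eqᵇ⇒≡ i≟r = cong (_∨ (f ⋆ A) i) fr
  ... | false with pairSupport A f i in supported
  ...   | true  = refl
  ...   | false = ⊥-elim (true≢false (trans (sym (cong₂ (λ a b → a ∧ not b) i∈N[r] supported)) (inside i)))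

2*[1+d]≤n⇒2*d<n∸1 : ∀ d n → 2 * suc d ≤ n → 2 * d < n ∸ 1
2*[1+d]≤n⇒2*d<n∸1 d (suc n) 2+2d≤1+n = ≤-pred (subst (_≤ suc n) (*-suc 2 d) 2+2d≤1+n)

2*m≡m+m : ∀ m → 2 * m ≡ m + m
2*m≡m+m m = cong (m +_) (+-identityʳ m)

half-of-sum : ∀ a b n → a + b ≤ n → 2 * a ≤ n ⊎ 2 * b ≤ n
half-of-sum a b n a+b≤n with ≤-total a b
... | inj₁ a≤b = inj₁ (≤-trans (≤-reflexive (2*m≡m+m a)) (≤-trans (+-monoʳ-≤ a a≤b) a+b≤n))
... | inj₂ b≤a = inj₂ (≤-trans (≤-reflexive (2*m≡m+m b)) (≤-trans (+-monoˡ-≤ b b≤a) a+b≤n))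

LocallyEquivalentToLowDegree : ∀ {n} → Graph n → Set
LocallyEquivalentToLowDegree {n} G =
  Σ (Graph n) (λ H → LocallyEquivalent G H × Σ (Fin n) (λ v → 2 * degree H v < n ∸ 1))

smallSupport⇒lowDegree : ∀ {n} (G : Graph n) f → Nonzero f → 2 * count (pairSupport (adj G) f) ≤ n →
  LocallyEquivalentToLowDegree G
smallSupport⇒lowDegree {n} G f f≢0 small with neighbourhood-inside-support (symmetric G) f f≢0 ≤-refl
... | B , G~B , v , inside = record { adj = B ; symmetric = Star-symmetric (symmetric G) G~B } , G~B , v , low
  where
  low : 2 * countᵇ (nbrᵇ B v) < n ∸ 1
  low rewrite countᵇ≡count (nbrᵇ B v) = 2*[1+d]≤n⇒2*d<n∸1 (count (nbrᵇ B v)) n (begin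
    2 * suc (count (nbrᵇ B v))           ≡⟨ cong (2 *_) (sym (count-closedNbhd B v)) ⟩
    2 * count (closedNbhd B v)           ≤⟨ *-monoʳ-≤ 2 (count-mono inside) ⟩
    2 * count (pairSupport (adj G) f)    ≤⟨ small ⟩
    n                                    ∎)
    where open ≤-Reasoning

kappa<n⇔disjointSupports : ∀ {n} (G : Graph n) → (kappa (IAScols G) < n) ⇔ DisjointSupports (adj G)
kappa<n⇔disjointSupports G =
  mk⇔ (covered⇒disjointSupports G ∘ kappa<dim⇒covered (IAS-identityColumns G))
      (covered⇒kappa<dim (IAS-identityColumns G) ∘ disjointSupports⇒covered G)

disjointSupports⇔lowDegree : ∀ {n} (G : Graph n) → DisjointSupports (adj G) ⇔ LocallyEquivalentToLowDegree G
disjointSupports⇔lowDegree {n} G = mk⇔ to from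
  where
  to : DisjointSupports (adj G) → LocallyEquivalentToLowDegree G
  to (f , g , f≢0 , g≢0 , disjoint)
    with half-of-sum (count (pairSupport (adj G) f)) (count (pairSupport (adj G) g)) n
                     (count-disjoint (pairSupport (adj G) f) (pairSupport (adj G) g) disjoint)
  ... | inj₁ f-small = smallSupport⇒lowDegree G f f≢0 f-small
  ... | inj₂ g-small = smallSupport⇒lowDegree G g g≢0 g-small
  from : LocallyEquivalentToLowDegree G → DisjointSupports (adj G)
  from (H , G~H , v , low) =
    Star-reflects-disjoint (symmetric G) G~H
      (lowDegree⇒disjointSupports (symmetric H) v (subst (λ d → 2 * d < n ∸ 1) (countᵇ≡count (nbrᵇ (adj H) v)) low))

theorem5 : (n : ℕ) → 4 ≤ n → (G : Graph n) →
    (kappa (IAScols G) < n) ⇔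
      Σ (Graph n) (λ H → LocallyEquivalent G H × Σ (Fin n) (λ v → 2 * degree H v < n ∸ 1))
theorem5 n _ G = ⇔-trans (kappa<n⇔disjointSupports G) (disjointSupports⇔lowDegree G)
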